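{- Let $n,k,r$ be positive integers and let $\mathcal{P}(n,r,1)$ be the set of lattice paths with steps $U=(1,1)$ and $D=(1,-r)$ from $(0,0)$ to $((r+1)n+1,1)$. Then: (1) for each $j=0,\dots,k-1$, the number of paths in $\mathcal{P}(n,r,1)$ with $k-1$ peaks that start with a down step and end with an up step and have exactly $j$ peaks on or below the $x$-axis is $\frac{1}{k}\binom{rn}{k-1}\binom{n-1}{k-1}$; (2) for each $j=0,\dots,k-1$, the number of paths in $\mathcal{P}(n,r,1)$ with $k-1$ valleys that start with an up step and end with a down step and have exactly $j$ valleys on or below the $x$-axis is $\frac{1}{k}\binom{rn}{k-1}\binom{n-1}{k-1}$; (3) for each $j=0,\dots,rn-k$, the number of paths in $\mathcal{P}(n,r,1)$ with $rn-k$ double rises that start with an up step and end with an up step and have exactly $j$ double rises on or below the $x$-axis is $\frac{1}{rn-k+1}\binom{rn}{k}\binom{n-1}{k-1}$; (4) if $k<n$, for each $j=0,\dots,n-k-1$, the number of paths in $\mathcal{P}(n,r,1)$ with $n-k-1$ double falls that start with a down step and end with a down step and have exactly $j$ double falls on or below the $x$-axis is $\frac{1}{n-k}\binom{rn}{k-1}\binom{n-1}{k}$; (5) for each $j=1,\dots,rn+1$, the number of paths in $\mathcal{P}(n,r,1)$ with $k$ peaks that start with an up step and have exactly $j$ up steps starting on or below the $x$-axis is $\frac{1}{rn+1}\binom{rn+1}{k}\binom{n-1}{k-1}$; (6) for each $j=1,\dots,n$, the number of paths in $\mathcal{P}(n,r,1)$ with $k$ valleys that start with a down step and have exactly $j$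 down steps starting on or below the $x$-axis is $\frac{1}{n}\binom{rn}{k-1}\binom{n}{k}$.
   Context: Encode a path as a word in $U,D$. A peak is an occurrence of $UD$, a valley an occurrence of $DU$, a double rise an occurrence of $UU$, a double fall an occurrence of $DD$; such an occurrence lies on or below the $x$-axis if the vertex between its two steps has $y$-coordinate $\le0$. A step starts on or below the $x$-axis if its initial vertex has $y$-coordinate $\le 0$. -}

module Defs where

open import Data.Bool using (Bool; true; false; _∧_; if_then_else_)
open import Data.Nat using (ℕ; zero; suc; _+_; _*_; _≡ᵇ_)
open import Data.Integer using (ℤ; +_; -_; _≤ᵇ_; 0ℤ) renaming (_+_ to _+ℤ_)
open import Data.List using (List; []; _∷_; map; _++_; length)

data Step : Set where
  U D : Step

_==ˢ_ : Step → Step → Bool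
U ==ˢ U = true
D ==ˢ D = true
_ ==ˢ _ = false

val : ℕ → Step → ℤ
val r U = + 1
val r D = - (+ r)

words : ℕ → List (List Step)
words zero = [] ∷ []
words (suc m) = map (U ∷_) (words m) ++ map (D ∷_) (words m)

heightFrom : ℕ → ℤ → List Step → ℤ
heightFrom r h [] = h
heightFrom r h (x ∷ w) = heightFrom r (h +ℤ val r x) w

infix 4 _==ℤ_ _==ˢ_
_==ℤ_ : ℤ → ℤ → Bool
a ==ℤ b = (a ≤ᵇ b) ∧ (b ≤ᵇ a)

inP : ℕ → ℕ → List Step → Bool
inP n r w = (length w ≡ᵇ (suc r * n + 1)) ∧ (heightFrom r 0ℤ w ==ℤ (+ 1))

occ : Step → Step → List Step → ℕ
occ a b (x ∷ y ∷ w) = (if (x ==ˢ a) ∧ (y ==ˢ b) then 1 else 0) + occ a b (y ∷ w)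
occ a b _ = 0

-- number of occurrences of the factor ab whose middle vertex has y ≤ 0,
-- the path being at height h before its first step
lowOccFrom : ℕ → Step → Step → ℤ → List Step → ℕ
lowOccFrom r a b h (x ∷ y ∷ w) =
  (if (x ==ˢ a) ∧ (y ==ˢ b) ∧ ((h +ℤ val r x) ≤ᵇ 0ℤ) then 1 else 0)
  + lowOccFrom r a b (h +ℤ val r x) (y ∷ w)
lowOccFrom r a b h _ = 0

lowOcc : ℕ → Step → Step → List Step → ℕ
lowOcc r a b w = lowOccFrom r a b 0ℤ w

lowStartsFrom : ℕ → Step → ℤ → List Step → ℕ
lowStartsFrom r s h [] = 0
lowStartsFrom r s h (x ∷ w) =
  (if (x ==ˢ s) ∧ (h ≤ᵇ 0ℤ) then 1 else 0) + lowStartsFrom r s (h +ℤ val r x) w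

lowStarts : ℕ → Step → List Step → ℕ
lowStarts r s w = lowStartsFrom r s 0ℤ w

startsWith : Step → List Step → Bool
startsWith s [] = false
startsWith s (x ∷ _) = x ==ˢ s

endsWith : Step → List Step → Bool
endsWith s [] = false
endsWith s (x ∷ []) = x ==ˢ s
endsWith s (_ ∷ y ∷ w) = endsWith s (y ∷ w)

count : {A : Set} → (A → Bool) → List A → ℕ
count p [] = 0
count p (x ∷ xs) = (if p x then 1 else 0) + count p xs

#P : ℕ → ℕ → (List Step → Bool) → ℕ
#P n r p = count (λ w → inP n r w ∧ p w) (words (suc r * n + 1))

-- A cycle-lemma argument. Rotations permute the words of a given length and preserve P(n,r,1),
-- since the height of a path only depends on its multiset of steps. Read a path cyclically and mark
-- the corners relevant to the statistic (occurrences of a factor, or starts of a given step).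
-- Because the whole path rises by exactly 1, in the rotation starting at a marked corner c the
-- number of low marked corners is the rank of c among the marked corners ordered by height,
-- ties broken towards later positions. So each path has exactly one rotation per value j, the
-- fibres of the statistic all have the same size, and each is a K-th of the paths with the
-- prescribed factor counts and end steps. Those are counted by compositions: a word from s to e
-- with p peaks has p + [e = U] runs of up steps and p + [s = D] runs of down steps, and the
-- remaining statistics are linear in p, the number of up steps and the end steps.

module Submission where

open import Defs
open import Data.Bool using (Bool; true; false; _∧_; not; if_then_else_; T)
open import Data.Bool.Properties using (∧-assoc; ∧-zeroʳ; ∧-identityʳ)
open import Data.Unit using (tt)
open import Data.Empty using (⊥-elim)
open import Data.Nat using (ℕ; zero; suc; _+_; _*_; _∸_; _≤_; _<_; _≡ᵇ_; _<ᵇ_; z≤n; s≤s; NonZero; >-nonZero)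
open import Data.Nat.Properties
open import Data.Nat.Combinatorics using (_C_; nCk+nC[k+1]≡[n+1]C[k+1])
open import Data.Integer using (ℤ; 0ℤ; 1ℤ) renaming (_+_ to _+ℤ_; _≤_ to _≤ℤ_; _<_ to _<ℤ_; _≤ᵇ_ to _≤ᵇℤ_)
import Data.Integer as ℤ
import Data.Integer.Properties as ℤ
import Data.Integer.Tactic.RingSolver as ℤ-Solver
import Data.Nat.Tactic.RingSolver as ℕ-Solver
open import Algebra.Bundles using (AbelianGroup)
open import Algebra.Properties.Group (AbelianGroup.group ℤ.+-0-abelianGroup) using () renaming (∙-cancelʳ to +ℤ-cancelʳ)
open import Data.List using (List; []; _∷_; map; _++_; length; take; drop; [_])
open import Data.List.Properties using (++-assoc; ++-identityʳ; take++drop≡id; length-++; length-++-≤ˡ)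
open import Data.List.Relation.Unary.All using (All; []; _∷_)
import Data.List.Relation.Unary.All as All
import Data.List.Relation.Unary.All.Properties as All
open import Data.List.Relation.Unary.AllPairs using (AllPairs; []; _∷_)
open import Data.List.Membership.Propositional using (_∈_)
open import Data.List.Relation.Unary.Any using (here; there)
open import Data.Product using (_×_; _,_; proj₁; proj₂; ∃₂)
open import Function using (_∘_; _⇔_; mk⇔; Equivalence)
open import Algebra.Properties.CommutativeSemigroup +-commutativeSemigroup
  using (x∙yz≈y∙xz) renaming (interchange to +-interchange)
open import Relation.Binary.PropositionalEquality hiding ([_])
open import Relation.Binary.Definitions using (tri<; tri≈; tri>)
open import Relation.Nullary using (yes; no)

toℕ : Bool → ℕ
toℕ b = if b then 1 else 0

T-ext : ∀ {x y : Bool} → (T x → T y) → (T y → T x) → x ≡ y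
T-ext {false} {false} _ _ = refl
T-ext {false} {true}  _ g = ⊥-elim (g tt)
T-ext {true}  {false} f _ = ⊥-elim (f tt)
T-ext {true}  {true}  _ _ = refl

Bool-ext : ∀ {x y : Bool} → (x ≡ true → y ≡ true) → (y ≡ true → x ≡ true) → x ≡ y
Bool-ext {false} {false} _ _ = refl
Bool-ext {false} {true}  _ g = g refl
Bool-ext {true}  {false} f _ = sym (f refl)
Bool-ext {true}  {true}  _ _ = refl

≡ᵇ-true : ∀ {m n} → m ≡ n → (m ≡ᵇ n) ≡ true
≡ᵇ-true {m} refl = T-ext (λ _ → tt) (λ _ → ≡⇒≡ᵇ m m refl)

≡ᵇ-false : ∀ {m n} → m ≢ n → (m ≡ᵇ n) ≡ false
≡ᵇ-false {m} {n} m≢n = T-ext (λ t → ⊥-elim (m≢n (≡ᵇ⇒≡ m n t))) (λ ())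

≡ᵇ-sound : ∀ {m n} → (m ≡ᵇ n) ≡ true → m ≡ n
≡ᵇ-sound {m} {n} e = ≡ᵇ⇒≡ m n (subst T (sym e) tt)

≡ᵇ-cancelˡ : ∀ x y s t → x + y ≡ s + t → (x ≡ᵇ s) ≡ (y ≡ᵇ t)
≡ᵇ-cancelˡ x y s t e = T-ext
  (λ h → ≡⇒≡ᵇ y t (+-cancelˡ-≡ x y t (trans e (cong (_+ t) (sym (≡ᵇ⇒≡ x s h))))))
  (λ h → ≡⇒≡ᵇ x s (+-cancelʳ-≡ y x s (trans e (cong (s +_) (sym (≡ᵇ⇒≡ y t h))))))

∧-true-left : ∀ {a b} → a ∧ b ≡ true → a ≡ true
∧-true-left {true} _ = refl

∧-true-right : ∀ {a b} → a ∧ b ≡ true → b ≡ true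
∧-true-right {true} e = e

∧-assoc₃ : ∀ a b c d → (a ∧ (b ∧ c)) ∧ d ≡ a ∧ (b ∧ (c ∧ d))
∧-assoc₃ a b c d = trans (∧-assoc a (b ∧ c) d) (cong (a ∧_) (∧-assoc b c d))

reorder : ∀ i o o′ s e → (i ≡ true → s ≡ true → e ≡ true → o ≡ o′) →
  i ∧ (o ∧ (s ∧ e)) ≡ s ∧ (e ∧ (i ∧ o′))
reorder true  o o′ true  true  o≡o′ = trans (∧-identityʳ o) (o≡o′ refl refl refl)
reorder true  o o′ true  false _    = ∧-zeroʳ o
reorder true  o o′ false e     _    = ∧-zeroʳ o
reorder false o o′ true  true  _    = refl
reorder false o o′ true  false _    = refl
reorder false o o′ false e     _    = refl

count-++ : ∀ {A : Set} (p : A → Bool) xs ys → count p (xs ++ ys) ≡ count p xs + count p ys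
count-++ p []       ys = refl
count-++ p (x ∷ xs) ys = trans (cong (toℕ (p x) +_) (count-++ p xs ys)) (sym (+-assoc (toℕ (p x)) _ _))

count-map : ∀ {A B : Set} (p : B → Bool) (f : A → B) xs → count p (map f xs) ≡ count (p ∘ f) xs
count-map p f []       = refl
count-map p f (x ∷ xs) = cong (toℕ (p (f x)) +_) (count-map p f xs)

count-cong : ∀ {A : Set} {p q : A → Bool} xs → (∀ x → p x ≡ q x) → count p xs ≡ count q xs
count-cong []       e = refl
count-cong (x ∷ xs) e = cong₂ (λ b n → toℕ b + n) (e x) (count-cong xs e)

count-cong-All : ∀ {A : Set} {p q : A → Bool} {xs} → All (λ x → p x ≡ q x) xs → count p xs ≡ count q xs
count-cong-All []       = refl
count-cong-All (e ∷ es) = cong₂ (λ b n → toℕ b + n) e (count-cong-All es)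

count-∧-split : ∀ {A : Set} (p q : A → Bool) xs →
  count p xs ≡ count (λ x → p x ∧ q x) xs + count (λ x → p x ∧ not (q x)) xs
count-∧-split p q []       = refl
count-∧-split p q (x ∷ xs) =
  trans (cong₂ _+_ (split (p x) (q x)) (count-∧-split p q xs)) (+-interchange (toℕ (p x ∧ q x)) _ _ _)
  where
  split : ∀ a b → toℕ a ≡ toℕ (a ∧ b) + toℕ (a ∧ not b)
  split true  true  = refl
  split true  false = refl
  split false _     = refl

count-false : ∀ {A : Set} (xs : List A) → count (λ _ → false) xs ≡ 0
count-false []       = refl
count-false (x ∷ xs) = count-false xs

count≤length : ∀ {A : Set} (p : A → Bool) xs → count p xs ≤ length xs
count≤length p []       = z≤n
count≤length p (x ∷ xs) with p x
... | true  = s≤s (count≤length p xs)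
... | false = m≤n⇒m≤1+n (count≤length p xs)

count-mono : ∀ {A : Set} {p q : A → Bool} → (∀ x → p x ≡ true → q x ≡ true) → ∀ xs → count p xs ≤ count q xs
count-mono h [] = z≤n
count-mono {p = p} {q} h (x ∷ xs) with p x in px
... | true  rewrite h x px = s≤s (count-mono h xs)
... | false = ≤-trans (count-mono h xs) (m≤n+m _ (toℕ (q x)))

count-mono-< : ∀ {A : Set} {p q : A → Bool} → (∀ x → p x ≡ true → q x ≡ true) →
  ∀ {y} xs → y ∈ xs → p y ≡ false → q y ≡ true → count p xs < count q xs
count-mono-< h (x ∷ xs) (here refl) py qy rewrite py | qy = s≤s (count-mono h xs)
count-mono-< {p = p} {q} h (x ∷ xs) (there y∈xs) py qy with p x in px
... | true  rewrite h x px = s≤s (count-mono-< h xs y∈xs py qy)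
... | false = ≤-trans (count-mono-< h xs y∈xs py qy) (m≤n+m _ (toℕ (q x)))

sumBelow : ℕ → (ℕ → ℕ) → ℕ
sumBelow zero    F = 0
sumBelow (suc n) F = F 0 + sumBelow n (F ∘ suc)

sumBelow-cong : ∀ n {F G : ℕ → ℕ} → (∀ i → i < n → F i ≡ G i) → sumBelow n F ≡ sumBelow n G
sumBelow-cong zero    e = refl
sumBelow-cong (suc n) e = cong₂ _+_ (e 0 (s≤s z≤n)) (sumBelow-cong n (λ i i<n → e (suc i) (s≤s i<n)))

sumBelow-const : ∀ n c → sumBelow n (λ _ → c) ≡ n * c
sumBelow-const zero    c = refl
sumBelow-const (suc n) c = cong (c +_) (sumBelow-const n c)

sumBelow-+ : ∀ n (F G : ℕ → ℕ) → sumBelow n (λ i → F i + G i) ≡ sumBelow n F + sumBelow n G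
sumBelow-+ zero    F G = refl
sumBelow-+ (suc n) F G =
  trans (cong (F 0 + G 0 +_) (sumBelow-+ n (F ∘ suc) (G ∘ suc))) (+-interchange (F 0) (G 0) _ _)

sumBelow-count : ∀ {A : Set} n (p : ℕ → A → Bool) (q : A → Bool) →
  (∀ x → sumBelow n (λ i → toℕ (p i x)) ≡ toℕ (q x)) →
  ∀ xs → sumBelow n (λ i → count (p i) xs) ≡ count q xs
sumBelow-count n p q h []       = trans (sumBelow-const n 0) (*-zeroʳ n)
sumBelow-count n p q h (x ∷ xs) =
  trans (sumBelow-+ n (λ i → toℕ (p i x)) (λ i → count (p i) xs))
        (cong₂ _+_ (h x) (sumBelow-count n p q h xs))

sumBelow-indicator : ∀ K o v → o ≤ v → v < o + K → sumBelow K (λ j → toℕ (v ≡ᵇ o + j)) ≡ 1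
sumBelow-indicator zero    o v o≤v v<o = ⊥-elim (<-irrefl refl (<-≤-trans v<o (≤-trans (≤-reflexive (+-identityʳ o)) o≤v)))
sumBelow-indicator (suc K) o v o≤v v<o+K with v ≟ o
... | yes refl = cong₂ _+_ (cong toℕ (≡ᵇ-true (sym (+-identityʳ v))))
                          (trans (sumBelow-cong K (λ j _ → cong toℕ (≡ᵇ-false (λ e → m≢1+m+n v (trans e (+-suc v j))))))
                                 (trans (sumBelow-const K 0) (*-zeroʳ K)))
... | no v≢o = cong₂ _+_ (cong toℕ (≡ᵇ-false (λ e → v≢o (trans e (+-identityʳ o)))))
                        (trans (sumBelow-cong K (λ j _ → cong (λ z → toℕ (v ≡ᵇ z)) (+-suc o j)))
                               (sumBelow-indicator K (suc o) v (≤∧≢⇒< o≤v (v≢o ∘ sym)) (subst (v <_) (+-suc o K) v<o+K)))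

-- Words and their rotations

words-length : ∀ n → All (λ w → length w ≡ n) (words n)
words-length zero    = refl ∷ []
words-length (suc n) = All.++⁺ (All.map⁺ (All.map (cong suc) (words-length n)))
                               (All.map⁺ (All.map (cong suc) (words-length n)))

count-words-cong : ∀ {n} {p q : List Step → Bool} →
  (∀ w → length w ≡ n → p w ≡ q w) → count p (words n) ≡ count q (words n)
count-words-cong {n} h = count-cong-All (All.map (λ {w} → h w) (words-length n))

count-words-suc : ∀ (p : List Step → Bool) m →
  count p (words (suc m)) ≡ count (p ∘ (U ∷_)) (words m) + count (p ∘ (D ∷_)) (words m)
count-words-suc p m = trans (count-++ p (map (U ∷_) (words m)) _)
  (cong₂ _+_ (count-map p (U ∷_) (words m)) (count-map p (D ∷_) (words m)))

count-words-cong-∷ : ∀ {m} {p q : List Step → Bool} → 1 ≤ m →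
  (∀ x w → p (x ∷ w) ≡ q (x ∷ w)) → count p (words m) ≡ count q (words m)
count-words-cong-∷ {suc m} {p} {q} _ h = begin
    count p (words (suc m))
  ≡⟨ count-words-suc p m ⟩
    count (p ∘ (U ∷_)) (words m) + count (p ∘ (D ∷_)) (words m)
  ≡⟨ cong₂ _+_ (count-cong (words m) (h U)) (count-cong (words m) (h D)) ⟩
    count (q ∘ (U ∷_)) (words m) + count (q ∘ (D ∷_)) (words m)
  ≡⟨ count-words-suc q m ⟨
    count q (words (suc m))
  ∎
  where open ≡-Reasoning

count-words-snoc : ∀ m (p : List Step → Bool) →
  count p (words (suc m)) ≡ count (λ w → p (w ++ [ U ])) (words m) + count (λ w → p (w ++ [ D ])) (words m)
count-words-snoc zero    p = cong (_+ (toℕ (p [ D ]) + 0)) (sym (+-identityʳ (toℕ (p [ U ]))))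
count-words-snoc (suc m) p = begin
    count p (words (suc (suc m)))
  ≡⟨ count-words-suc p (suc m) ⟩
    count (p ∘ (U ∷_)) (words (suc m)) + count (p ∘ (D ∷_)) (words (suc m))
  ≡⟨ cong₂ _+_ (count-words-snoc m (p ∘ (U ∷_))) (count-words-snoc m (p ∘ (D ∷_))) ⟩
    (#UU + #UD) + (#DU + #DD)
  ≡⟨ +-interchange #UU #UD #DU #DD ⟩
    (#UU + #DU) + (#UD + #DD)
  ≡⟨ cong₂ _+_ (count-words-suc (λ w → p (w ++ [ U ])) m) (count-words-suc (λ w → p (w ++ [ D ])) m) ⟨
    count (λ w → p (w ++ [ U ])) (words (suc m)) + count (λ w → p (w ++ [ D ])) (words (suc m))
  ∎
  where
  open ≡-Reasoning
  #UU = count (λ w → p (U ∷ w ++ [ U ])) (words m)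
  #UD = count (λ w → p (U ∷ w ++ [ D ])) (words m)
  #DU = count (λ w → p (D ∷ w ++ [ U ])) (words m)
  #DD = count (λ w → p (D ∷ w ++ [ D ])) (words m)

rotate : List Step → List Step
rotate []      = []
rotate (x ∷ w) = w ++ [ x ]

rotate^ : ℕ → List Step → List Step
rotate^ zero    w = w
rotate^ (suc i) w = rotate^ i (rotate w)

count-words-rotate : ∀ m (p : List Step → Bool) → count (p ∘ rotate) (words m) ≡ count p (words m)
count-words-rotate zero    p = refl
count-words-rotate (suc m) p = trans (count-words-suc (p ∘ rotate) m) (sym (count-words-snoc m p))

count-words-rotate^ : ∀ i m (p : List Step → Bool) → count (p ∘ rotate^ i) (words m) ≡ count p (words m)
count-words-rotate^ zero    m p = refl
count-words-rotate^ (suc i) m p = trans (count-words-rotate m (p ∘ rotate^ i)) (count-words-rotate^ i m p)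

rotate^-invariant : ∀ (E : List Step → Bool) → (∀ w → E (rotate w) ≡ E w) → ∀ i w → E (rotate^ i w) ≡ E w
rotate^-invariant E h zero    w = refl
rotate^-invariant E h (suc i) w = trans (rotate^-invariant E h i (rotate w)) (h w)

take-++ˡ : ∀ {A : Set} i (u v : List A) → i ≤ length u → take i (u ++ v) ≡ take i u
take-++ˡ zero    u       v _         = refl
take-++ˡ (suc i) (x ∷ u) v (s≤s i≤u) = cong (x ∷_) (take-++ˡ i u v i≤u)

drop-++ˡ : ∀ {A : Set} i (u v : List A) → i ≤ length u → drop i (u ++ v) ≡ drop i u ++ v
drop-++ˡ zero    u       v _         = refl
drop-++ˡ (suc i) (x ∷ u) v (s≤s i≤u) = drop-++ˡ i u v i≤u

rotate^≡drop++take : ∀ i w → i ≤ length w → rotate^ i w ≡ drop i w ++ take i w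
rotate^≡drop++take zero    w       _         = sym (++-identityʳ w)
rotate^≡drop++take (suc i) (x ∷ w) (s≤s i≤w) = begin
    rotate^ i (w ++ [ x ])
  ≡⟨ rotate^≡drop++take i (w ++ [ x ]) (≤-trans i≤w (length-++-≤ˡ w)) ⟩
    drop i (w ++ [ x ]) ++ take i (w ++ [ x ])
  ≡⟨ cong₂ _++_ (drop-++ˡ i w [ x ] i≤w) (take-++ˡ i w [ x ] i≤w) ⟩
    (drop i w ++ [ x ]) ++ take i w
  ≡⟨ ++-assoc (drop i w) [ x ] (take i w) ⟩
    drop i w ++ x ∷ take i w
  ∎
  where open ≡-Reasoning

-- Heights and corners

+ℤ-swapʳ : ∀ a b c → (a +ℤ b) +ℤ c ≡ (a +ℤ c) +ℤ b
+ℤ-swapʳ a b c = trans (ℤ.+-assoc a b c) (trans (cong (a +ℤ_) (ℤ.+-comm b c)) (sym (ℤ.+-assoc a c b)))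

heightFrom-++ : ∀ r h (u v : List Step) → heightFrom r h (u ++ v) ≡ heightFrom r (heightFrom r h u) v
heightFrom-++ r h []      v = refl
heightFrom-++ r h (x ∷ u) v = heightFrom-++ r (h +ℤ val r x) u v

heightFrom-raise : ∀ r h c (w : List Step) → heightFrom r (h +ℤ c) w ≡ heightFrom r h w +ℤ c
heightFrom-raise r h c []      = refl
heightFrom-raise r h c (x ∷ w) =
  trans (cong (λ z → heightFrom r z w) (+ℤ-swapʳ h c (val r x))) (heightFrom-raise r (h +ℤ val r x) c w)

record Corner : Set where
  constructor corner
  field
    into out : Step
    height : ℤ
open Corner

-- The corners of a walk: the starting vertex of each step, with its height and the steps
-- entering and leaving it, for a walk started at height h and entered by the step p.
corners : ℕ → ℤ → Step → List Step → List Corner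
corners r h p []      = []
corners r h p (x ∷ w) = corner p x h ∷ corners r (h +ℤ val r x) x w

lastOf : Step → List Step → Step
lastOf p []      = p
lastOf p (x ∷ w) = lastOf x w

lastStep : List Step → Step
lastStep []      = U
lastStep (x ∷ w) = lastOf x w

-- Reading w cyclically, its first vertex is entered by its last step.
cyclicCorners : ℕ → List Step → List Corner
cyclicCorners r w = corners r 0ℤ (lastStep w) w

firstCorner : List Corner → Corner
firstCorner []      = corner U U 0ℤ
firstCorner (t ∷ _) = t

raise : ℤ → Corner → Corner
raise c (corner p x g) = corner p x (g +ℤ c)

RaiseInvariant : (Corner → Bool) → Set
RaiseInvariant f = ∀ c t → f (raise c t) ≡ f t

isFactor : Step → Step → Corner → Bool
isFactor a b t = (into t ==ˢ a) ∧ (out t ==ˢ b)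

leaves : Step → Corner → Bool
leaves s t = out t ==ˢ s

low : Corner → Bool
low t = height t ≤ᵇℤ 0ℤ

count-raise : ∀ {f} → RaiseInvariant f → ∀ c ts → count f (map (raise c) ts) ≡ count f ts
count-raise {f} f-inv c ts = trans (count-map f (raise c) ts) (count-cong ts (f-inv c))

length-corners : ∀ r h p (w : List Step) → length (corners r h p w) ≡ length w
length-corners r h p []      = refl
length-corners r h p (x ∷ w) = cong suc (length-corners r (h +ℤ val r x) x w)

corners-raise : ∀ r c p (w : List Step) → corners r c p w ≡ map (raise c) (corners r 0ℤ p w)
corners-raise r c p w = trans (cong (λ z → corners r z p w) (sym (ℤ.+-identityˡ c))) (go 0ℤ p w)
  where
  go : ∀ h p w → corners r (h +ℤ c) p w ≡ map (raise c) (corners r h p w)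
  go h p []      = refl
  go h p (x ∷ w) = cong (corner p x (h +ℤ c) ∷_)
    (trans (cong (λ z → corners r z x w) (+ℤ-swapʳ h c (val r x))) (go (h +ℤ val r x) x w))

corners-++ : ∀ r h p (u v : List Step) →
  corners r h p (u ++ v) ≡ corners r h p u ++ corners r (heightFrom r h u) (lastOf p u) v
corners-++ r h p []      v = refl
corners-++ r h p (x ∷ u) v = cong (corner p x h ∷_) (corners-++ r (h +ℤ val r x) x u v)

take-corners : ∀ r h p i (w : List Step) → take i (corners r h p w) ≡ corners r h p (take i w)
take-corners r h p zero    w       = refl
take-corners r h p (suc i) []      = refl
take-corners r h p (suc i) (x ∷ w) = cong (corner p x h ∷_) (take-corners r (h +ℤ val r x) x i w)

drop-corners : ∀ r h p i (w : List Step) →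
  drop i (corners r h p w) ≡ corners r (heightFrom r h (take i w)) (lastOf p (take i w)) (drop i w)
drop-corners r h p zero    w       = refl
drop-corners r h p (suc i) []      = refl
drop-corners r h p (suc i) (x ∷ w) = drop-corners r (h +ℤ val r x) x i w

lastOf-++ : ∀ p (u v : List Step) → lastOf p (u ++ v) ≡ lastOf (lastOf p u) v
lastOf-++ p []      v = refl
lastOf-++ p (x ∷ u) v = lastOf-++ x u v

lastStep-drop : ∀ i (w : List Step) → i < length w → lastStep (drop i w) ≡ lastStep w
lastStep-drop zero    w           _                 = refl
lastStep-drop (suc i) (x ∷ y ∷ w) (s≤s (s≤s i<w))   = lastStep-drop i (y ∷ w) (s≤s i<w)

drop-∷ : ∀ i (w : List Step) → i < length w → ∃₂ λ x v → drop i w ≡ x ∷ v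
drop-∷ zero    (x ∷ w) _         = x , w , refl
drop-∷ (suc i) (x ∷ w) (s≤s i<w) = drop-∷ i w i<w

firstCorner-map : ∀ (g : Corner → Corner) ts → 0 < length ts → firstCorner (map g ts) ≡ g (firstCorner ts)
firstCorner-map g (t ∷ ts) _ = refl

firstCorner-++ : ∀ ts ss → 0 < length ts → firstCorner (ts ++ ss) ≡ firstCorner ts
firstCorner-++ (t ∷ ts) ss _ = refl

height-firstCorner : ∀ r h p (w : List Step) → 0 < length w → height (firstCorner (corners r h p w)) ≡ h
height-firstCorner r h p (x ∷ w) _ = refl

≤ᵇℤ-+ʳ : ∀ a b k → ((a +ℤ k) ≤ᵇℤ (b +ℤ k)) ≡ (a ≤ᵇℤ b)
≤ᵇℤ-+ʳ a b k = T-ext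
  (λ t → ℤ.≤⇒≤ᵇ (subst₂ _≤ℤ_ (cancel a) (cancel b)
                             (ℤ.+-monoˡ-≤ (ℤ.- k) (ℤ.≤ᵇ⇒≤ {a +ℤ k} {b +ℤ k} t))))
  (λ t → ℤ.≤⇒≤ᵇ (ℤ.+-monoˡ-≤ k (ℤ.≤ᵇ⇒≤ {a} {b} t)))
  where
  cancel : ∀ x → (x +ℤ k) +ℤ ℤ.- k ≡ x
  cancel x = trans (ℤ.+-assoc x k (ℤ.- k)) (trans (cong (x +ℤ_) (ℤ.+-inverseʳ k)) (ℤ.+-identityʳ x))

-- The marked corners that are low once the word is rotated to start at position i, of height g:
-- the corners after i keep their height relative to g, those before i are moved behind the end
-- and so lie one unit higher, as the word rises by 1 overall.
lowAfterRotation : (Corner → Bool) → List Corner → ℤ → ℕ → ℕ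
lowAfterRotation f ts g i =
  count (λ t → f t ∧ (height t ≤ᵇℤ g)) (drop i ts) + count (λ t → f t ∧ (ℤ.suc (height t) ≤ᵇℤ g)) (take i ts)

module Rotation (r : ℕ) (w : List Step) (i : ℕ) (i<w : i < length w) where

  rotated : List Step
  rotated = drop i w ++ take i w

  Z : List Corner
  Z = cyclicCorners r w

  entry : Step
  entry = lastOf (lastStep w) (take i w)

  riseBefore riseAfter : ℤ
  riseBefore = heightFrom r 0ℤ (take i w)
  riseAfter  = heightFrom r 0ℤ (drop i w)

  Zafter : List Corner
  Zafter = corners r 0ℤ entry (drop i w)

  drop-nonempty : 0 < length (drop i w)
  drop-nonempty with drop i w | drop-∷ i w i<w
  ... | _ | x , v , refl = s≤s z≤n

  Zafter-nonempty : 0 < length Zafter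
  Zafter-nonempty = subst (0 <_) (sym (length-corners r 0ℤ entry (drop i w))) drop-nonempty

  lastOf-drop : ∀ p → lastOf p (drop i w) ≡ lastStep w
  lastOf-drop p with drop i w | drop-∷ i w i<w | lastStep-drop i w i<w
  ... | _ | x , v , refl | e = e

  lastStep-rotated : lastStep rotated ≡ entry
  lastStep-rotated with drop i w | drop-∷ i w i<w | lastStep-drop i w i<w
  ... | _ | x , v , refl | e = trans (lastOf-++ x v (take i w)) (cong (λ z → lastOf z (take i w)) e)

  cyclicCorners-rotated : cyclicCorners r rotated ≡ Zafter ++ map (raise riseAfter) (take i Z)
  cyclicCorners-rotated = begin
      corners r 0ℤ (lastStep rotated) rotated
    ≡⟨ cong (λ p → corners r 0ℤ p rotated) lastStep-rotated ⟩
      corners r 0ℤ entry (drop i w ++ take i w)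
    ≡⟨ corners-++ r 0ℤ entry (drop i w) (take i w) ⟩
      Zafter ++ corners r riseAfter (lastOf entry (drop i w)) (take i w)
    ≡⟨ cong (λ p → Zafter ++ corners r riseAfter p (take i w)) (lastOf-drop entry) ⟩
      Zafter ++ corners r riseAfter (lastStep w) (take i w)
    ≡⟨ cong (Zafter ++_) (corners-raise r riseAfter (lastStep w) (take i w)) ⟩
      Zafter ++ map (raise riseAfter) (corners r 0ℤ (lastStep w) (take i w))
    ≡⟨ cong (λ ts → Zafter ++ map (raise riseAfter) ts) (take-corners r 0ℤ (lastStep w) i w) ⟨
      Zafter ++ map (raise riseAfter) (take i Z)
    ∎
    where open ≡-Reasoning

  drop-Z : drop i Z ≡ map (raise riseBefore) Zafter
  drop-Z = trans (drop-corners r 0ℤ (lastStep w) i w) (corners-raise r riseBefore entry (drop i w))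

  heightFrom-split : heightFrom r 0ℤ w ≡ riseAfter +ℤ riseBefore
  heightFrom-split = begin
      heightFrom r 0ℤ w
    ≡⟨ cong (heightFrom r 0ℤ) (take++drop≡id i w) ⟨
      heightFrom r 0ℤ (take i w ++ drop i w)
    ≡⟨ heightFrom-++ r 0ℤ (take i w) (drop i w) ⟩
      heightFrom r riseBefore (drop i w)
    ≡⟨ cong (λ h → heightFrom r h (drop i w)) (ℤ.+-identityˡ riseBefore) ⟨
      heightFrom r (0ℤ +ℤ riseBefore) (drop i w)
    ≡⟨ heightFrom-raise r 0ℤ riseBefore (drop i w) ⟩
      riseAfter +ℤ riseBefore
    ∎
    where open ≡-Reasoning

  firstCorner-drop-Z : firstCorner (drop i Z) ≡ raise riseBefore (firstCorner (cyclicCorners r rotated))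
  firstCorner-drop-Z = begin
      firstCorner (drop i Z)
    ≡⟨ cong firstCorner drop-Z ⟩
      firstCorner (map (raise riseBefore) Zafter)
    ≡⟨ firstCorner-map (raise riseBefore) Zafter Zafter-nonempty ⟩
      raise riseBefore (firstCorner Zafter)
    ≡⟨ cong (raise riseBefore) (firstCorner-++ Zafter _ Zafter-nonempty) ⟨
      raise riseBefore (firstCorner (Zafter ++ map (raise riseAfter) (take i Z)))
    ≡⟨ cong (raise riseBefore ∘ firstCorner) cyclicCorners-rotated ⟨
      raise riseBefore (firstCorner (cyclicCorners r rotated))
    ∎
    where open ≡-Reasoning

  height-firstCorner-drop-Z : height (firstCorner (drop i Z)) ≡ 0ℤ +ℤ riseBefore
  height-firstCorner-drop-Z =
    trans (cong height (trans (cong firstCorner drop-Z) (firstCorner-map (raise riseBefore) Zafter Zafter-nonempty)))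
          (cong (_+ℤ riseBefore) (height-firstCorner r 0ℤ entry (drop i w) drop-nonempty))

  count-rotated : ∀ {f} → RaiseInvariant f → count f (cyclicCorners r rotated) ≡ count f Z
  count-rotated {f} f-inv = begin
      count f (cyclicCorners r rotated)
    ≡⟨ cong (count f) cyclicCorners-rotated ⟩
      count f (Zafter ++ map (raise riseAfter) (take i Z))
    ≡⟨ count-++ f Zafter _ ⟩
      count f Zafter + count f (map (raise riseAfter) (take i Z))
    ≡⟨ cong₂ _+_ (trans (sym (count-raise f-inv riseBefore Zafter)) (cong (count f) (sym drop-Z)))
                 (count-raise f-inv riseAfter (take i Z)) ⟩
      count f (drop i Z) + count f (take i Z)
    ≡⟨ +-comm (count f (drop i Z)) (count f (take i Z)) ⟩
      count f (take i Z) + count f (drop i Z)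
    ≡⟨ count-++ f (take i Z) (drop i Z) ⟨
      count f (take i Z ++ drop i Z)
    ≡⟨ cong (count f) (take++drop≡id i Z) ⟩
      count f Z
    ∎
    where open ≡-Reasoning

  count-low-rotated : ∀ {f} → RaiseInvariant f → heightFrom r 0ℤ w ≡ 1ℤ →
    count (λ t → f t ∧ low t) (cyclicCorners r rotated) ≡ lowAfterRotation f Z (height (firstCorner (drop i Z))) i
  count-low-rotated {f} f-inv height≡1 = begin
      count (λ t → f t ∧ low t) (cyclicCorners r rotated)
    ≡⟨ cong (count (λ t → f t ∧ low t)) cyclicCorners-rotated ⟩
      count (λ t → f t ∧ low t) (Zafter ++ map (raise riseAfter) (take i Z))
    ≡⟨ count-++ (λ t → f t ∧ low t) Zafter _ ⟩
      count (λ t → f t ∧ low t) Zafter + count (λ t → f t ∧ low t) (map (raise riseAfter) (take i Z))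
    ≡⟨ cong₂ _+_ after before ⟩
      lowAfterRotation f Z g i
    ∎
    where
    open ≡-Reasoning
    g = height (firstCorner (drop i Z))
    after : count (λ t → f t ∧ low t) Zafter ≡ count (λ t → f t ∧ (height t ≤ᵇℤ g)) (drop i Z)
    after = sym (begin
        count (λ t → f t ∧ (height t ≤ᵇℤ g)) (drop i Z)
      ≡⟨ cong (count (λ t → f t ∧ (height t ≤ᵇℤ g))) drop-Z ⟩
        count (λ t → f t ∧ (height t ≤ᵇℤ g)) (map (raise riseBefore) Zafter)
      ≡⟨ count-map _ (raise riseBefore) Zafter ⟩
        count (λ t → f (raise riseBefore t) ∧ ((height t +ℤ riseBefore) ≤ᵇℤ g)) Zafter
      ≡⟨ count-cong Zafter (λ t → cong₂ _∧_ (f-inv riseBefore t)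
           (trans (cong ((height t +ℤ riseBefore) ≤ᵇℤ_) height-firstCorner-drop-Z) (≤ᵇℤ-+ʳ (height t) 0ℤ riseBefore))) ⟩
        count (λ t → f t ∧ low t) Zafter
      ∎)
    moved : ∀ h → ((h +ℤ riseAfter) ≤ᵇℤ 0ℤ) ≡ (ℤ.suc h ≤ᵇℤ g)
    moved h = begin
        (h +ℤ riseAfter) ≤ᵇℤ 0ℤ
      ≡⟨ ≤ᵇℤ-+ʳ (h +ℤ riseAfter) 0ℤ riseBefore ⟨
        ((h +ℤ riseAfter) +ℤ riseBefore) ≤ᵇℤ (0ℤ +ℤ riseBefore)
      ≡⟨ cong₂ _≤ᵇℤ_ (trans (ℤ.+-assoc h riseAfter riseBefore)
                       (trans (cong (h +ℤ_) (trans (sym heightFrom-split) height≡1)) (ℤ.+-comm h 1ℤ)))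
                     (sym height-firstCorner-drop-Z) ⟩
        ℤ.suc h ≤ᵇℤ g
      ∎
    before : count (λ t → f t ∧ low t) (map (raise riseAfter) (take i Z))
               ≡ count (λ t → f t ∧ (ℤ.suc (height t) ≤ᵇℤ g)) (take i Z)
    before = trans (count-map _ (raise riseAfter) (take i Z))
                   (count-cong (take i Z) (λ t → cong₂ _∧_ (f-inv riseAfter t) (moved (height t))))

-- Ranks in a total order

count-cong-∈ : ∀ {A : Set} {p q : A → Bool} xs → (∀ {y} → y ∈ xs → p y ≡ q y) → count p xs ≡ count q xs
count-cong-∈ xs h = count-cong-All (All.tabulate h)

module Rank {A : Set} (_≼_ : A → A → Bool) (_#_ : A → A → Set)
  (≼-refl : ∀ x → (x ≼ x) ≡ true)
  (≼-trans : ∀ x y z → (x ≼ y) ≡ true → (y ≼ z) ≡ true → (x ≼ z) ≡ true)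
  (≼-total : ∀ x y → (x ≼ y) ≡ false → (y ≼ x) ≡ true)
  (≼-asym : ∀ x y → x # y → (x ≼ y) ≡ true → (y ≼ x) ≡ false) where

  rank : List A → A → ℕ
  rank xs y = count (λ x → x ≼ y) xs

  rank-self : ∀ x xs → rank (x ∷ xs) x ≡ suc (rank xs x)
  rank-self x xs rewrite ≼-refl x = refl

  rank-≤ : ∀ {x y} xs → (x ≼ y) ≡ false → rank xs y ≤ rank xs x
  rank-≤ {x} {y} xs x⋠y = count-mono (λ z z≼y → ≼-trans z y x z≼y (≼-total x y x⋠y)) xs

  rank-< : ∀ {x y} xs → All (x #_) xs → y ∈ xs → (x ≼ y) ≡ true → rank xs x < rank xs y
  rank-< {x} {y} xs x#xs y∈xs x≼y =
    count-mono-< (λ z z≼x → ≼-trans z x y z≼x x≼y) xs y∈xs (≼-asym x y (All.lookup x#xs y∈xs) x≼y) (≼-refl y)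

  rank-unique : ∀ xs → AllPairs _#_ xs → ∀ J → 1 ≤ J → J ≤ length xs → count (λ y → rank xs y ≡ᵇ J) xs ≡ 1
  rank-unique []       _                 J 1≤J J≤0 = ⊥-elim (<⇒≱ 1≤J J≤0)
  rank-unique (x ∷ xs) (x#xs ∷ distinct) J 1≤J J≤ with <-cmp J (suc (rank xs x))
  ... | tri< J<x _ _ = begin
      toℕ (rank (x ∷ xs) x ≡ᵇ J) + count (λ y → rank (x ∷ xs) y ≡ᵇ J) xs
    ≡⟨ cong₂ _+_ (cong toℕ (trans (cong (_≡ᵇ J) (rank-self x xs)) (≡ᵇ-false (>⇒≢ J<x))))
                 (count-cong-∈ xs same) ⟩
      count (λ y → rank xs y ≡ᵇ J) xs
    ≡⟨ rank-unique xs distinct J 1≤J (≤-trans (≤-pred J<x) (count≤length _ xs)) ⟩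
      1
    ∎
    where
    open ≡-Reasoning
    same : ∀ {y} → y ∈ xs → (rank (x ∷ xs) y ≡ᵇ J) ≡ (rank xs y ≡ᵇ J)
    same {y} y∈xs with x ≼ y in x≼y
    ... | false = refl
    ... | true  = trans (≡ᵇ-false (>⇒≢ (<-trans J<x (s≤s (rank-< xs x#xs y∈xs x≼y)))))
                        (sym (≡ᵇ-false (>⇒≢ (<-≤-trans J<x (rank-< xs x#xs y∈xs x≼y)))))
  ... | tri≈ _ refl _ = begin
      toℕ (rank (x ∷ xs) x ≡ᵇ J) + count (λ y → rank (x ∷ xs) y ≡ᵇ J) xs
    ≡⟨ cong₂ _+_ (cong toℕ (trans (cong (_≡ᵇ J) (rank-self x xs)) (≡ᵇ-true {suc (rank xs x)} refl)))
                 (count-cong-∈ xs missed) ⟩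
      1 + count (λ _ → false) xs
    ≡⟨ cong suc (count-false xs) ⟩
      1
    ∎
    where
    open ≡-Reasoning
    missed : ∀ {y} → y ∈ xs → (rank (x ∷ xs) y ≡ᵇ J) ≡ false
    missed {y} y∈xs with x ≼ y in x≼y
    ... | false = ≡ᵇ-false (<⇒≢ (s≤s (rank-≤ xs x≼y)))
    ... | true  = ≡ᵇ-false (>⇒≢ (s≤s (rank-< xs x#xs y∈xs x≼y)))
  ... | tri> _ _ x<J = go J x<J J≤
    where
    go : ∀ J → suc (rank xs x) < J → J ≤ suc (length xs) → count (λ y → rank (x ∷ xs) y ≡ᵇ J) (x ∷ xs) ≡ 1
    go (suc J) (s≤s x<J) (s≤s J≤) = begin
        toℕ (rank (x ∷ xs) x ≡ᵇ suc J) + count (λ y → rank (x ∷ xs) y ≡ᵇ suc J) xs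
      ≡⟨ cong₂ _+_ (cong toℕ (trans (cong (_≡ᵇ suc J) (rank-self x xs)) (≡ᵇ-false (<⇒≢ (s≤s x<J)))))
                   (count-cong-∈ xs shifted) ⟩
        count (λ y → rank xs y ≡ᵇ J) xs
      ≡⟨ rank-unique xs distinct J (≤-trans (s≤s z≤n) x<J) J≤ ⟩
        1
      ∎
      where
      open ≡-Reasoning
      shifted : ∀ {y} → y ∈ xs → (rank (x ∷ xs) y ≡ᵇ suc J) ≡ (rank xs y ≡ᵇ J)
      shifted {y} y∈xs with x ≼ y in x≼y
      ... | true  = refl
      ... | false = trans (≡ᵇ-false (<⇒≢ (≤-trans (s≤s (rank-≤ xs x≼y)) (≤-trans x<J (n≤1+n J)))))
                          (sym (≡ᵇ-false (<⇒≢ (≤-trans (s≤s (rank-≤ xs x≼y)) x<J))))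

Key : Set
Key = ℤ × ℕ

-- Keys are (height, position); ordered by height, and at equal heights the later position first.
_≼_ : Key → Key → Bool
(g , q) ≼ (g′ , q′) = if q <ᵇ q′ then ℤ.suc g ≤ᵇℤ g′ else g ≤ᵇℤ g′

_#_ : Key → Key → Set
(_ , q) # (_ , q′) = q < q′

data _≼ᴾ_ : Key → Key → Set where
  earlier : ∀ {g q g′ q′} → q < q′ → ℤ.suc g ≤ℤ g′ → (g , q) ≼ᴾ (g′ , q′)
  later   : ∀ {g q g′ q′} → q′ ≤ q → g ≤ℤ g′ → (g , q) ≼ᴾ (g′ , q′)

<ᵇ-true : ∀ {a b} → a < b → (a <ᵇ b) ≡ true
<ᵇ-true a<b = T-ext (λ _ → tt) (λ _ → <⇒<ᵇ a<b)

<ᵇ-false : ∀ {a b} → b ≤ a → (a <ᵇ b) ≡ false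
<ᵇ-false {a} {b} b≤a = T-ext (λ t → ⊥-elim (<⇒≱ (<ᵇ⇒< a b t) b≤a)) (λ ())

≤ᵇℤ-true : ∀ {a b} → a ≤ℤ b → (a ≤ᵇℤ b) ≡ true
≤ᵇℤ-true a≤b = T-ext (λ _ → tt) (λ _ → ℤ.≤⇒≤ᵇ a≤b)

≤ᵇℤ-sound : ∀ {a b} → (a ≤ᵇℤ b) ≡ true → a ≤ℤ b
≤ᵇℤ-sound {a} {b} e = ℤ.≤ᵇ⇒≤ (subst T (sym e) tt)

≤ᵇℤ-false : ∀ {a b} → (a ≤ᵇℤ b) ≡ false → b <ℤ a
≤ᵇℤ-false e = ℤ.≰⇒> (λ a≤b → subst T e (ℤ.≤⇒≤ᵇ a≤b))

≼-earlier : ∀ h g {q q′} → q < q′ → ((h , q) ≼ (g , q′)) ≡ (ℤ.suc h ≤ᵇℤ g)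
≼-earlier h g q<q′ rewrite <ᵇ-true q<q′ = refl

≼-later : ∀ h g {q q′} → q′ ≤ q → ((h , q) ≼ (g , q′)) ≡ (h ≤ᵇℤ g)
≼-later h g q′≤q rewrite <ᵇ-false q′≤q = refl

≼-sound : ∀ x y → (x ≼ y) ≡ true → x ≼ᴾ y
≼-sound (g , q) (g′ , q′) e with q <ᵇ q′ in q<q′
... | true  = earlier (<ᵇ⇒< q q′ (subst T (sym q<q′) tt)) (≤ᵇℤ-sound e)
... | false = later (≮⇒≥ (λ q<q′′ → subst T q<q′ (<⇒<ᵇ q<q′′))) (≤ᵇℤ-sound e)

≼-complete : ∀ {x y} → x ≼ᴾ y → (x ≼ y) ≡ true
≼-complete {g , _} {g′ , _} (earlier q<q′ g<g′) = trans (≼-earlier g g′ q<q′) (≤ᵇℤ-true g<g′)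
≼-complete {g , _} {g′ , _} (later q′≤q g≤g′)   = trans (≼-later g g′ q′≤q) (≤ᵇℤ-true g≤g′)

≼-refl : ∀ x → (x ≼ x) ≡ true
≼-refl (g , q) = ≼-complete {g , q} {g , q} (later ≤-refl ℤ.≤-refl)

≼ᴾ-trans : ∀ {x y z} → x ≼ᴾ y → y ≼ᴾ z → x ≼ᴾ z
≼ᴾ-trans (earlier a b) (earlier c d) = earlier (<-trans a c) (ℤ.≤-trans b (ℤ.≤-trans (ℤ.i≤suc[i] _) d))
≼ᴾ-trans {_ , q} {z = _ , q′′} (earlier a b) (later c d) with q <? q′′
... | yes q<q′′ = earlier q<q′′ (ℤ.≤-trans b d)
... | no  q≮q′′ = later (≮⇒≥ q≮q′′) (ℤ.≤-trans (ℤ.i≤suc[i] _) (ℤ.≤-trans b d))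
≼ᴾ-trans {_ , q} {z = _ , q′′} (later a b) (earlier c d) with q <? q′′
... | yes q<q′′ = earlier q<q′′ (ℤ.≤-trans (ℤ.suc-mono b) d)
... | no  q≮q′′ = later (≮⇒≥ q≮q′′) (ℤ.≤-trans b (ℤ.≤-trans (ℤ.i≤suc[i] _) d))
≼ᴾ-trans (later a b) (later c d) = later (≤-trans c a) (ℤ.≤-trans b d)

≼-trans : ∀ x y z → (x ≼ y) ≡ true → (y ≼ z) ≡ true → (x ≼ z) ≡ true
≼-trans x y z x≼y y≼z = ≼-complete (≼ᴾ-trans (≼-sound x y x≼y) (≼-sound y z y≼z))

≼-total : ∀ x y → (x ≼ y) ≡ false → (y ≼ x) ≡ true
≼-total (g , q) (g′ , q′) e with q <ᵇ q′ in q<q′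
... | true  = ≼-complete {g′ , q′} {g , q} (later (<⇒≤ (<ᵇ⇒< q q′ (subst T (sym q<q′) tt)))
                                (ℤ.≮⇒≥ (λ g<g′ → ℤ.<-irrefl refl
                                   (ℤ.<-≤-trans (≤ᵇℤ-false {ℤ.suc g} {g′} e) (ℤ.i<j⇒suc[i]≤j g<g′)))))
... | false with q′ <? q
...   | yes q′<q = ≼-complete {g′ , q′} {g , q} (earlier q′<q (ℤ.i<j⇒suc[i]≤j (≤ᵇℤ-false {g} {g′} e)))
...   | no  q′≮q = ≼-complete {g′ , q′} {g , q} (later (≮⇒≥ q′≮q) (ℤ.<⇒≤ (≤ᵇℤ-false {g} {g′} e)))

≼-asym : ∀ x y → x # y → (x ≼ y) ≡ true → (y ≼ x) ≡ false
≼-asym (g , q) (g′ , q′) q<q′ e rewrite <ᵇ-true q<q′ | <ᵇ-false (<⇒≤ q<q′) =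
  T-ext (λ t → ⊥-elim (ℤ.<-irrefl refl (ℤ.<-≤-trans (ℤ.suc[i]≤j⇒i<j (≤ᵇℤ-sound e)) (ℤ.≤ᵇ⇒≤ {g′} {g} t))))
        (λ ())

open Rank _≼_ _#_ ≼-refl ≼-trans ≼-total ≼-asym

module MarkedCorners (f : Corner → Bool) where

  markedKeys : ℕ → List Corner → List Key
  markedKeys o []       = []
  markedKeys o (t ∷ ts) = if f t then (height t , o) ∷ markedKeys (suc o) ts else markedKeys (suc o) ts

  count-markedKeys-∷ : ∀ (P : Key → Bool) o t ts →
    count P (markedKeys o (t ∷ ts)) ≡ toℕ (f t ∧ P (height t , o)) + count P (markedKeys (suc o) ts)
  count-markedKeys-∷ P o t ts with f t
  ... | true  = refl
  ... | false = refl

  length-markedKeys : ∀ o ts → length (markedKeys o ts) ≡ count f ts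
  length-markedKeys o []       = refl
  length-markedKeys o (t ∷ ts) with f t
  ... | true  = cong suc (length-markedKeys (suc o) ts)
  ... | false = length-markedKeys (suc o) ts

  markedKeys-≥ : ∀ o ts → All (λ k → o ≤ proj₂ k) (markedKeys o ts)
  markedKeys-≥ o []       = []
  markedKeys-≥ o (t ∷ ts) with f t
  ... | true  = ≤-refl ∷ All.map (≤-trans (n≤1+n o)) (markedKeys-≥ (suc o) ts)
  ... | false = All.map (≤-trans (n≤1+n o)) (markedKeys-≥ (suc o) ts)

  markedKeys-distinct : ∀ o ts → AllPairs _#_ (markedKeys o ts)
  markedKeys-distinct o []       = []
  markedKeys-distinct o (t ∷ ts) with f t
  ... | true  = markedKeys-≥ (suc o) ts ∷ markedKeys-distinct (suc o) ts
  ... | false = markedKeys-distinct (suc o) ts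

  rank-markedKeys-≥ : ∀ g m o ts → m ≤ o →
    count (λ k → k ≼ (g , m)) (markedKeys o ts) ≡ count (λ t → f t ∧ (height t ≤ᵇℤ g)) ts
  rank-markedKeys-≥ g m o []       _   = refl
  rank-markedKeys-≥ g m o (t ∷ ts) m≤o =
    trans (count-markedKeys-∷ (λ k → k ≼ (g , m)) o t ts)
          (cong₂ (λ b n → toℕ (f t ∧ b) + n) (≼-later (height t) g m≤o)
                 (rank-markedKeys-≥ g m (suc o) ts (m≤n⇒m≤1+n m≤o)))

  rank-markedKeys : ∀ g o i ts → count (λ k → k ≼ (g , o + i)) (markedKeys o ts) ≡ lowAfterRotation f ts g i
  rank-markedKeys g o zero ts =
    trans (rank-markedKeys-≥ g (o + 0) o ts (≤-reflexive (+-identityʳ o))) (sym (+-identityʳ _))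
  rank-markedKeys g o (suc i) []       = refl
  rank-markedKeys g o (suc i) (t ∷ ts) = begin
      count (λ k → k ≼ (g , o + suc i)) (markedKeys o (t ∷ ts))
    ≡⟨ count-markedKeys-∷ (λ k → k ≼ (g , o + suc i)) o t ts ⟩
      toℕ (f t ∧ ((height t , o) ≼ (g , o + suc i))) + count (λ k → k ≼ (g , o + suc i)) (markedKeys (suc o) ts)
    ≡⟨ cong₂ (λ b n → toℕ (f t ∧ b) + n)
             (≼-earlier (height t) g (m<m+n o (s≤s z≤n)))
             (trans (cong (λ m → count (λ k → k ≼ (g , m)) (markedKeys (suc o) ts)) (+-suc o i))
                    (rank-markedKeys g (suc o) i ts)) ⟩
      toℕ (f t ∧ (ℤ.suc (height t) ≤ᵇℤ g)) + (count (λ t → f t ∧ (height t ≤ᵇℤ g)) (drop i ts)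
                                              + count (λ t → f t ∧ (ℤ.suc (height t) ≤ᵇℤ g)) (take i ts))
    ≡⟨ x∙yz≈y∙xz (toℕ (f t ∧ (ℤ.suc (height t) ≤ᵇℤ g)))
                 (count (λ t → f t ∧ (height t ≤ᵇℤ g)) (drop i ts)) (count (λ t → f t ∧ (ℤ.suc (height t) ≤ᵇℤ g)) (take i ts)) ⟩
      lowAfterRotation f (t ∷ ts) g (suc i)
    ∎
    where open ≡-Reasoning

  sumBelow-markedKeys : ∀ (P : Key → Bool) o ts →
    sumBelow (length ts) (λ i → toℕ (f (firstCorner (drop i ts)) ∧ P (height (firstCorner (drop i ts)) , o + i)))
      ≡ count P (markedKeys o ts)
  sumBelow-markedKeys P o []       = refl
  sumBelow-markedKeys P o (t ∷ ts) =
    trans (cong₂ _+_ (cong (λ m → toℕ (f t ∧ P (height t , m))) (+-identityʳ o))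
                     (trans (sumBelow-cong (length ts) (λ i _ →
                               cong (λ m → toℕ (f (firstCorner (drop i ts)) ∧ P (height (firstCorner (drop i ts)) , m))) (+-suc o i)))
                            (sumBelow-markedKeys P (suc o) ts)))
          (sym (count-markedKeys-∷ P o t ts))

  -- At a marked position, lowAfterRotation is the rank of its key among the marked keys.
  lowAfterRotation-unique : ∀ ts J → 1 ≤ J → J ≤ count f ts →
    sumBelow (length ts) (λ i → toℕ (f (firstCorner (drop i ts))
                                     ∧ (lowAfterRotation f ts (height (firstCorner (drop i ts))) i ≡ᵇ J))) ≡ 1
  lowAfterRotation-unique ts J 1≤J J≤ = begin
      sumBelow (length ts) (λ i → toℕ (f (firstCorner (drop i ts))
                                       ∧ (lowAfterRotation f ts (height (firstCorner (drop i ts))) i ≡ᵇ J)))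
    ≡⟨ sumBelow-cong (length ts) (λ i _ → cong (λ n → toℕ (f (firstCorner (drop i ts)) ∧ (n ≡ᵇ J)))
                                               (sym (rank-markedKeys (height (firstCorner (drop i ts))) 0 i ts))) ⟩
      sumBelow (length ts) (λ i → toℕ (f (firstCorner (drop i ts))
                                       ∧ (rank keys (height (firstCorner (drop i ts)) , i) ≡ᵇ J)))
    ≡⟨ sumBelow-markedKeys (λ k → rank keys k ≡ᵇ J) 0 ts ⟩
      count (λ k → rank keys k ≡ᵇ J) keys
    ≡⟨ rank-unique keys (markedKeys-distinct 0 ts) J 1≤J (subst (J ≤_) (sym (length-markedKeys 0 ts)) J≤) ⟩
      1
    ∎
    where
    open ≡-Reasoning
    keys = markedKeys 0 ts

-- The cycle lemma

sumBelow-∧ : ∀ n b (F : ℕ → Bool) → (b ≡ true → sumBelow n (toℕ ∘ F) ≡ 1) →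
  sumBelow n (λ i → toℕ (b ∧ F i)) ≡ toℕ b
sumBelow-∧ n false F _ = trans (sumBelow-const n 0) (*-zeroʳ n)
sumBelow-∧ n true  F h = h refl

module CycleLemma (r N : ℕ) (E : List Step → Bool)
  (E-rotate : ∀ w → E (rotate w) ≡ E w)
  (E-shape : ∀ w → E w ≡ true → length w ≡ N × heightFrom r 0ℤ w ≡ 1ℤ)
  (f g : Corner → Bool) (f-inv : RaiseInvariant f) (g-inv : RaiseInvariant g) (m : ℕ) where

  Global : List Step → Bool
  Global w = E w ∧ (count g (cyclicCorners r w) ≡ᵇ m)

  -- w starts at the marked corner of rank J of its cycle.
  Rooted : ℕ → List Step → Bool
  Rooted J w = E w ∧ ((count g (cyclicCorners r w) ≡ᵇ m) ∧ (f (firstCorner (cyclicCorners r w))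
                                                          ∧ (count (λ t → f t ∧ low t) (cyclicCorners r w) ≡ᵇ J)))

  Rooted-rotate^ : ∀ J w i → i < N →
    Rooted J (rotate^ i w) ≡ Global w ∧ (f (firstCorner (drop i (cyclicCorners r w)))
      ∧ (lowAfterRotation f (cyclicCorners r w) (height (firstCorner (drop i (cyclicCorners r w)))) i ≡ᵇ J))
  Rooted-rotate^ J w i i<N with E w in Ew
  ... | false = cong (λ b → b ∧ _) (trans (rotate^-invariant E E-rotate i w) Ew)
  ... | true  = begin
      Rooted J (rotate^ i w)
    ≡⟨ cong (Rooted J) (rotate^≡drop++take i w (<⇒≤ i<w)) ⟩
      Rooted J rotated
    ≡⟨ cong (λ b → b ∧ ((count g Zr ≡ᵇ m) ∧ (f (firstCorner Zr) ∧ (count (λ t → f t ∧ low t) Zr ≡ᵇ J))))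
            (trans (cong E (sym (rotate^≡drop++take i w (<⇒≤ i<w)))) (trans (rotate^-invariant E E-rotate i w) Ew)) ⟩
      (count g Zr ≡ᵇ m) ∧ (f (firstCorner Zr) ∧ (count (λ t → f t ∧ low t) Zr ≡ᵇ J))
    ≡⟨ cong₂ (λ n b → (n ≡ᵇ m) ∧ b) (count-rotated g-inv)
         (cong₂ (λ a n → a ∧ (n ≡ᵇ J))
                (trans (sym (f-inv riseBefore (firstCorner Zr))) (cong f (sym firstCorner-drop-Z)))
                (count-low-rotated f-inv (proj₂ (E-shape w Ew)))) ⟩
      (count g Z ≡ᵇ m) ∧ (f (firstCorner (drop i Z)) ∧ (lowAfterRotation f Z (height (firstCorner (drop i Z))) i ≡ᵇ J))
    ∎
    where
    open ≡-Reasoning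
    i<w : i < length w
    i<w = subst (i <_) (sym (proj₁ (E-shape w Ew))) i<N
    open Rotation r w i i<w
    Zr = cyclicCorners r rotated

  module _ (J : ℕ) (1≤J : 1 ≤ J) (J≤marked : ∀ w → Global w ≡ true → J ≤ count f (cyclicCorners r w)) where

    rotations-Rooted : ∀ w → sumBelow N (λ i → toℕ (Rooted J (rotate^ i w))) ≡ toℕ (Global w)
    rotations-Rooted w =
      trans (sumBelow-cong N (λ i i<N → cong toℕ (Rooted-rotate^ J w i i<N)))
            (sumBelow-∧ N (Global w) _ λ G → trans
              (cong (λ n → sumBelow n _) (sym (trans (length-corners r 0ℤ (lastStep w) w) (proj₁ (E-shape w (∧-true-left G))))))
              (MarkedCorners.lowAfterRotation-unique f (cyclicCorners r w) J 1≤J (J≤marked w G)))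

    -- Rotation permutes the words of length N.
    cycle-lemma : N * count (Rooted J) (words N) ≡ count Global (words N)
    cycle-lemma = begin
        N * count (Rooted J) (words N)
      ≡⟨ sumBelow-const N _ ⟨
        sumBelow N (λ _ → count (Rooted J) (words N))
      ≡⟨ sumBelow-cong N (λ i _ → sym (count-words-rotate^ i N (Rooted J))) ⟩
        sumBelow N (λ i → count (Rooted J ∘ rotate^ i) (words N))
      ≡⟨ sumBelow-count N (λ i → Rooted J ∘ rotate^ i) Global rotations-Rooted (words N) ⟩
        count Global (words N)
      ∎
      where open ≡-Reasoning

occ-corners : ∀ r a b h p (w : List Step) → occ a b w ≡ count (isFactor a b) (drop 1 (corners r h p w))
occ-corners r a b h p []          = refl
occ-corners r a b h p (x ∷ [])    = refl
occ-corners r a b h p (x ∷ y ∷ w) = cong (toℕ ((x ==ˢ a) ∧ (y ==ˢ b)) +_) (occ-corners r a b (h +ℤ val r x) x (y ∷ w))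

lowOcc-corners : ∀ r a b h p (w : List Step) →
  lowOccFrom r a b h w ≡ count (λ t → isFactor a b t ∧ low t) (drop 1 (corners r h p w))
lowOcc-corners r a b h p []          = refl
lowOcc-corners r a b h p (x ∷ [])    = refl
lowOcc-corners r a b h p (x ∷ y ∷ w) =
  cong₂ (λ c n → toℕ c + n) (sym (∧-assoc (x ==ˢ a) (y ==ˢ b) ((h +ℤ val r x) ≤ᵇℤ 0ℤ)))
        (lowOcc-corners r a b (h +ℤ val r x) x (y ∷ w))

lowStarts-corners : ∀ r s h p (w : List Step) → lowStartsFrom r s h w ≡ count (λ t → leaves s t ∧ low t) (corners r h p w)
lowStarts-corners r s h p []      = refl
lowStarts-corners r s h p (x ∷ w) = cong (toℕ ((x ==ˢ s) ∧ (h ≤ᵇℤ 0ℤ)) +_) (lowStarts-corners r s (h +ℤ val r x) x w)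

endsWith-lastOf : ∀ s x (v : List Step) → endsWith s (x ∷ v) ≡ (lastOf x v ==ˢ s)
endsWith-lastOf s x []      = refl
endsWith-lastOf s x (y ∷ v) = endsWith-lastOf s y v

==ˢ-sound : ∀ {x s} → (x ==ˢ s) ≡ true → x ≡ s
==ˢ-sound {U} {U} _ = refl
==ˢ-sound {D} {D} _ = refl

prepend-occurrence : ∀ {A A′ B B′ : ℕ} {s e e′ : Bool} K j → A ≡ A′ → B ≡ B′ → e ≡ e′ →
  (A ≡ᵇ K) ∧ (s ∧ (e ∧ (B ≡ᵇ j)))
    ≡ (toℕ (e′ ∧ s) + A′ ≡ᵇ suc K) ∧ ((e′ ∧ s) ∧ (toℕ ((e′ ∧ s) ∧ true) + B′ ≡ᵇ suc j))
prepend-occurrence {A} {s = true}  {true}  K j refl refl refl = refl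
prepend-occurrence {A} {s = true}  {false} K j refl refl refl = trans (∧-zeroʳ (A ≡ᵇ K)) (sym (∧-zeroʳ _))
prepend-occurrence {A} {s = false} {true}  K j refl refl refl = trans (∧-zeroʳ (A ≡ᵇ K)) (sym (∧-zeroʳ _))
prepend-occurrence {A} {s = false} {false} K j refl refl refl = trans (∧-zeroʳ (A ≡ᵇ K)) (sym (∧-zeroʳ _))

prepend-non-occurrence : ∀ {A A′ n : ℕ} (s : Bool) L k → A ≡ A′ → (s ≡ true → n ≡ 0) →
  (A ≡ᵇ k) ∧ (s ∧ L) ≡ (n + A′ ≡ᵇ k) ∧ (s ∧ L)
prepend-non-occurrence {A} {n = n} false L k refl _  = trans (∧-zeroʳ (A ≡ᵇ k)) (sym (∧-zeroʳ (n + A ≡ᵇ k)))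
prepend-non-occurrence             true  L k refl n≡0 rewrite n≡0 refl = refl

-- A word starting with b and ending with a has one more cyclic occurrence of ab than linear
-- ones, at its first corner, which is low.
occurrences-cyclic : ∀ r a b K j x (v : List Step) →
  (occ a b (x ∷ v) ≡ᵇ K) ∧ (startsWith b (x ∷ v) ∧ (endsWith a (x ∷ v) ∧ (lowOcc r a b (x ∷ v) ≡ᵇ j)))
    ≡ (count (isFactor a b) (cyclicCorners r (x ∷ v)) ≡ᵇ suc K)
      ∧ (isFactor a b (firstCorner (cyclicCorners r (x ∷ v)))
         ∧ (count (λ t → isFactor a b t ∧ low t) (cyclicCorners r (x ∷ v)) ≡ᵇ suc j))
occurrences-cyclic r a b K j x v =
  prepend-occurrence K j (occ-corners r a b 0ℤ (lastOf x v) (x ∷ v)) (lowOcc-corners r a b 0ℤ (lastOf x v) (x ∷ v))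
                         (endsWith-lastOf a x v)

lowStarts-cyclic : ∀ r a b s → (s ==ˢ b) ≡ false → ∀ k j x (v : List Step) →
  (occ a b (x ∷ v) ≡ᵇ k) ∧ (startsWith s (x ∷ v) ∧ (lowStarts r s (x ∷ v) ≡ᵇ j))
    ≡ (count (isFactor a b) (cyclicCorners r (x ∷ v)) ≡ᵇ k)
      ∧ (leaves s (firstCorner (cyclicCorners r (x ∷ v)))
         ∧ (count (λ t → leaves s t ∧ low t) (cyclicCorners r (x ∷ v)) ≡ᵇ j))
lowStarts-cyclic r a b s s≠b k j x v =
  trans (cong (λ n → (occ a b (x ∷ v) ≡ᵇ k) ∧ ((x ==ˢ s) ∧ (n ≡ᵇ j))) (lowStarts-corners r s 0ℤ (lastOf x v) (x ∷ v)))
        (prepend-non-occurrence (x ==ˢ s) _ k (occ-corners r a b 0ℤ (lastOf x v) (x ∷ v)) first-not-factor)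
  where
  first-not-factor : (x ==ˢ s) ≡ true → toℕ ((lastOf x v ==ˢ a) ∧ (x ==ˢ b)) ≡ 0
  first-not-factor x≡s rewrite ==ˢ-sound x≡s | s≠b = cong toℕ (∧-zeroʳ (lastOf s v ==ˢ a))

lowOccFrom≤occ : ∀ r a b h (w : List Step) → lowOccFrom r a b h w ≤ occ a b w
lowOccFrom≤occ r a b h []          = z≤n
lowOccFrom≤occ r a b h (x ∷ [])    = z≤n
lowOccFrom≤occ r a b h (x ∷ y ∷ w) =
  +-mono-≤ (toℕ-mono (x ==ˢ a) (y ==ˢ b) ((h +ℤ val r x) ≤ᵇℤ 0ℤ)) (lowOccFrom≤occ r a b (h +ℤ val r x) (y ∷ w))
  where
  toℕ-mono : ∀ b₁ b₂ b₃ → toℕ (b₁ ∧ b₂ ∧ b₃) ≤ toℕ (b₁ ∧ b₂)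
  toℕ-mono true  true  true  = ≤-refl
  toℕ-mono true  true  false = z≤n
  toℕ-mono true  false _     = z≤n
  toℕ-mono false _     _     = z≤n

lowStartsFrom≤count : ∀ r s h (w : List Step) → lowStartsFrom r s h w ≤ count (_==ˢ s) w
lowStartsFrom≤count r s h []      = z≤n
lowStartsFrom≤count r s h (x ∷ w) =
  +-mono-≤ (toℕ-mono (x ==ˢ s) (h ≤ᵇℤ 0ℤ)) (lowStartsFrom≤count r s (h +ℤ val r x) w)
  where
  toℕ-mono : ∀ b₁ b₂ → toℕ (b₁ ∧ b₂) ≤ toℕ b₁
  toℕ-mono true  true  = ≤-refl
  toℕ-mono true  false = z≤n
  toℕ-mono false _     = z≤n

count-leaves : ∀ r s h p (w : List Step) → count (leaves s) (corners r h p w) ≡ count (_==ˢ s) w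
count-leaves r s h p []      = refl
count-leaves r s h p (x ∷ w) = cong (toℕ (x ==ˢ s) +_) (count-leaves r s (h +ℤ val r x) x w)

-- Equidistribution

module _ {A : Set} (xs : List A) (P : A → Bool) (v : A → ℕ) (T : ℕ → A → Bool)
  (T-fibre : ∀ j x → T j x ≡ P x ∧ (v x ≡ᵇ j))
  (K o : ℕ) (v-range : ∀ x → P x ≡ true → o ≤ v x × v x < o + K) where

  count-fibres : count P xs ≡ sumBelow K (λ i → count (T (o + i)) xs)
  count-fibres = sym (sumBelow-count K (λ i → T (o + i)) P per-element xs)
    where
    per-element : ∀ x → sumBelow K (λ i → toℕ (T (o + i) x)) ≡ toℕ (P x)
    per-element x = trans (sumBelow-cong K (λ i _ → cong toℕ (T-fibre (o + i) x)))
      (sumBelow-∧ K (P x) _ λ Px → sumBelow-indicator K o (v x) (proj₁ (v-range x Px)) (proj₂ (v-range x Px)))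

  -- Fibres whose N-fold counts agree have equal size, so each is a K-th of the whole.
  equidistribution : ∀ N .{{_ : NonZero N}} c → (∀ j → o ≤ j → j < o + K → N * count (T j) xs ≡ c) →
    ∀ j → o ≤ j → j < o + K → K * count (T j) xs ≡ count P xs
  equidistribution N c uniform j o≤j j<o+K = sym (begin
      count P xs
    ≡⟨ count-fibres ⟩
      sumBelow K (λ i → count (T (o + i)) xs)
    ≡⟨ sumBelow-cong K (λ i i<K → *-cancelˡ-≡ _ _ N (trans (uniform (o + i) (m≤m+n o i) (+-monoʳ-< o i<K))
                                                          (sym (uniform j o≤j j<o+K)))) ⟩
      sumBelow K (λ _ → count (T j) xs)
    ≡⟨ sumBelow-const K _ ⟩
      K * count (T j) xs
    ∎)
    where open ≡-Reasoning

-- Counting words by first and last step, number of up steps and number of peaks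

ups downs : List Step → ℕ
ups   = count (_==ˢ U)
downs = count (_==ˢ D)

-- The number of compositions of a into p positive parts.
compositions : ℕ → ℕ → ℕ
compositions zero    zero    = 1
compositions zero    (suc p) = 0
compositions (suc a) zero    = 0
compositions (suc a) (suc p) = a C p

compositions-pascal : ∀ b p → compositions b p + compositions b (suc p) ≡ compositions (suc b) (suc p)
compositions-pascal zero    zero    = refl
compositions-pascal zero    (suc p) = refl
compositions-pascal (suc b) zero    = refl
compositions-pascal (suc b) (suc p) = nCk+nC[k+1]≡[n+1]C[k+1] b p

Shape : Step → Step → ℕ → ℕ → List Step → Bool
Shape s e a p w = startsWith s w ∧ (endsWith e w ∧ ((ups w ≡ᵇ a) ∧ (occ U D w ≡ᵇ p)))

#Shape : ℕ → Step → Step → ℕ → ℕ → ℕ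
#Shape m s e a p = count (Shape s e a p) (words m)

-- A word from s to e with p peaks, a up steps and b down steps has p + [e = U] runs of
-- up steps and p + [s = D] runs of down steps.
shapeCount : Step → Step → ℕ → ℕ → ℕ → ℕ
shapeCount U U a b p = compositions a (suc p) * compositions b p
shapeCount U D a b p = compositions a p       * compositions b p
shapeCount D U a b p = compositions a (suc p) * compositions b (suc p)
shapeCount D D a b p = compositions a p       * compositions b (suc p)

#Shape-U : ∀ m e a p → #Shape (suc m) U e a p ≡ count (λ w → Shape U e a p (U ∷ w)) (words m)
#Shape-U m e a p = trans (count-words-suc (Shape U e a p) m)
                         (trans (cong (count (λ w → Shape U e a p (U ∷ w)) (words m) +_) (count-false (words m))) (+-identityʳ _))

#Shape-D : ∀ m e a p → #Shape (suc m) D e a p ≡ count (λ w → Shape D e a p (D ∷ w)) (words m)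
#Shape-D m e a p = trans (count-words-suc (Shape D e a p) m)
                         (cong (_+ count (λ w → Shape D e a p (D ∷ w)) (words m)) (count-false (words m)))

count-Shape : ∀ m s e a b p → a + b ≡ suc m → #Shape (suc m) s e a p ≡ shapeCount s e a b p
count-Shape zero U U 1 0 zero    refl = refl
count-Shape zero U U 1 0 (suc p) refl = sym (*-zeroʳ (compositions 1 (suc (suc p))))
count-Shape zero U U 0 1 zero    refl = refl
count-Shape zero U U 0 1 (suc p) refl = refl
count-Shape zero U D 1 0 zero    refl = refl
count-Shape zero U D 1 0 (suc p) refl = sym (*-zeroʳ (compositions 1 (suc p)))
count-Shape zero U D 0 1 zero    refl = refl
count-Shape zero U D 0 1 (suc p) refl = refl
count-Shape zero D U 1 0 zero    refl = refl
count-Shape zero D U 1 0 (suc p) refl = sym (*-zeroʳ (compositions 1 (suc (suc p))))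
count-Shape zero D U 0 1 zero    refl = refl
count-Shape zero D U 0 1 (suc p) refl = refl
count-Shape zero D D 1 0 zero    refl = refl
count-Shape zero D D 1 0 (suc p) refl = sym (*-zeroʳ (compositions 1 (suc p)))
count-Shape zero D D 0 1 zero    refl = refl
count-Shape zero D D 0 1 (suc p) refl = refl
count-Shape (suc m) U e zero b p a+b = begin
    #Shape (suc (suc m)) U e 0 p
  ≡⟨ #Shape-U (suc m) e 0 p ⟩
    count (λ w → Shape U e 0 p (U ∷ w)) (words (suc m))
  ≡⟨ count-cong (words (suc m)) (λ w → ∧-zeroʳ (endsWith e (U ∷ w))) ⟩
    count (λ _ → false) (words (suc m))
  ≡⟨ count-false (words (suc m)) ⟩
    0
  ≡⟨ no-ups e b p a+b ⟨
    shapeCount U e 0 b p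
  ∎
  where
  open ≡-Reasoning
  no-ups : ∀ e b p → b ≡ suc (suc m) → shapeCount U e 0 b p ≡ 0
  no-ups U b       p       _    = refl
  no-ups D .(suc (suc m)) zero refl = refl
  no-ups D b       (suc p) _    = refl
count-Shape (suc m) U e (suc a) b p a+b = begin
    #Shape (suc (suc m)) U e (suc a) p
  ≡⟨ #Shape-U (suc m) e (suc a) p ⟩
    count (λ w → Shape U e (suc a) p (U ∷ w)) (words (suc m))
  ≡⟨ count-words-suc (λ w → Shape U e (suc a) p (U ∷ w)) m ⟩
    count (λ w → Shape U e (suc a) p (U ∷ U ∷ w)) (words m) + count (λ w → Shape U e (suc a) p (U ∷ D ∷ w)) (words m)
  ≡⟨ cong₂ _+_ (sym (#Shape-U m e a p)) (then-down e p) ⟩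
    #Shape (suc m) U e a p + afterPeak e p
  ≡⟨ combine e p ⟩
    shapeCount U e (suc a) b p
  ∎
  where
  open ≡-Reasoning
  a+b≡ : a + b ≡ suc m
  a+b≡ = suc-injective a+b
  afterPeak : Step → ℕ → ℕ
  afterPeak e zero    = 0
  afterPeak e (suc p) = #Shape (suc m) D e a p
  then-down : ∀ e p → count (λ w → Shape U e (suc a) p (U ∷ D ∷ w)) (words m) ≡ afterPeak e p
  then-down e zero    = trans (count-cong (words m) (λ w → cong (endsWith e (D ∷ w) ∧_) (∧-zeroʳ (ups (D ∷ w) ≡ᵇ a))))
                              (trans (count-cong (words m) (λ w → ∧-zeroʳ (endsWith e (D ∷ w)))) (count-false (words m)))
  then-down e (suc p) = sym (#Shape-D m e a p)
  combine : ∀ e p → #Shape (suc m) U e a p + afterPeak e p ≡ shapeCount U e (suc a) b p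
  combine U zero    rewrite count-Shape m U U a b zero a+b≡ = trans (+-identityʳ _) (one-run a b a+b≡)
    where
    one-run : ∀ a b → a + b ≡ suc m → compositions a 1 * compositions b 0 ≡ compositions (suc a) 1 * compositions b 0
    one-run (suc a) b       _ = refl
    one-run zero    (suc b) _ = refl
  combine U (suc p) rewrite count-Shape m U U a b (suc p) a+b≡ | count-Shape m D U a b p a+b≡ =
    trans (sym (*-distribʳ-+ (compositions b (suc p)) (compositions a (suc (suc p))) (compositions a (suc p))))
          (cong (_* compositions b (suc p)) (trans (+-comm (compositions a (suc (suc p))) _) (compositions-pascal a (suc p))))
  combine D zero    rewrite count-Shape m U D a b zero a+b≡ = trans (+-identityʳ _) (no-run a b a+b≡)
    where
    no-run : ∀ a b → a + b ≡ suc m → compositions a 0 * compositions b 0 ≡ compositions (suc a) 0 * compositions b 0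
    no-run (suc a) b       _ = refl
    no-run zero    (suc b) _ = refl
  combine D (suc p) rewrite count-Shape m U D a b (suc p) a+b≡ | count-Shape m D D a b p a+b≡ =
    trans (sym (*-distribʳ-+ (compositions b (suc p)) (compositions a (suc p)) (compositions a p)))
          (cong (_* compositions b (suc p)) (trans (+-comm (compositions a (suc p)) _) (compositions-pascal a p)))
count-Shape (suc m) D e a zero p a+b = begin
    #Shape (suc (suc m)) D e a p
  ≡⟨ #Shape-D (suc m) e a p ⟩
    count (λ w → Shape D e a p (D ∷ w)) (words (suc m))
  ≡⟨ count-words-cong too-few-ups ⟩
    count (λ _ → false) (words (suc m))
  ≡⟨ count-false (words (suc m)) ⟩
    0
  ≡⟨ no-downs e ⟨
    shapeCount D e a 0 p
  ∎
  where
  open ≡-Reasoning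
  no-downs : ∀ e → shapeCount D e a 0 p ≡ 0
  no-downs U = *-zeroʳ (compositions a (suc p))
  no-downs D = *-zeroʳ (compositions a p)
  too-few-ups : ∀ w → length w ≡ suc m → Shape D e a p (D ∷ w) ≡ false
  too-few-ups w ∣w∣ = trans (cong (λ b → endsWith e (D ∷ w) ∧ (b ∧ (occ U D (D ∷ w) ≡ᵇ p))) (≡ᵇ-false ups≢a))
                            (∧-zeroʳ (endsWith e (D ∷ w)))
    where
    ups≢a : ups w ≢ a
    ups≢a ups≡a = ≤⇒≯ (subst (_≤ suc m) (trans ups≡a (trans (sym (+-identityʳ a)) a+b))
                             (subst (ups w ≤_) ∣w∣ (count≤length _ w)))
                      (n<1+n (suc m))
count-Shape (suc m) D e a (suc b) p a+b = begin
    #Shape (suc (suc m)) D e a p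
  ≡⟨ #Shape-D (suc m) e a p ⟩
    count (λ w → Shape D e a p (D ∷ w)) (words (suc m))
  ≡⟨ count-words-suc (λ w → Shape D e a p (D ∷ w)) m ⟩
    count (λ w → Shape D e a p (D ∷ U ∷ w)) (words m) + count (λ w → Shape D e a p (D ∷ D ∷ w)) (words m)
  ≡⟨ cong₂ _+_ (sym (#Shape-U m e a p)) (sym (#Shape-D m e a p)) ⟩
    #Shape (suc m) U e a p + #Shape (suc m) D e a p
  ≡⟨ combine e ⟩
    shapeCount D e a (suc b) p
  ∎
  where
  open ≡-Reasoning
  a+b≡ : a + b ≡ suc m
  a+b≡ = suc-injective (trans (sym (+-suc a b)) a+b)
  combine : ∀ e → #Shape (suc m) U e a p + #Shape (suc m) D e a p ≡ shapeCount D e a (suc b) p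
  combine U rewrite count-Shape m U U a b p a+b≡ | count-Shape m D U a b p a+b≡ =
    trans (sym (*-distribˡ-+ (compositions a (suc p)) (compositions b p) (compositions b (suc p))))
          (cong (compositions a (suc p) *_) (compositions-pascal b p))
  combine D rewrite count-Shape m U D a b p a+b≡ | count-Shape m D D a b p a+b≡ =
    trans (sym (*-distribˡ-+ (compositions a p) (compositions b p) (compositions b (suc p))))
          (cong (compositions a p *_) (compositions-pascal b p))

count-Shape⁺ : ∀ {N} s e a b p → a + b ≡ N → 1 ≤ N → #Shape N s e a p ≡ shapeCount s e a b p
count-Shape⁺ {suc m} s e a b p a+b _ = count-Shape m s e a b p a+b

ups-occ : ∀ (w : List Step) → occ U U w + occ U D w + toℕ (endsWith U w) ≡ ups w
ups-occ []          = refl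
ups-occ (U ∷ [])    = refl
ups-occ (D ∷ [])    = refl
ups-occ (U ∷ U ∷ w) = cong suc (ups-occ (U ∷ w))
ups-occ (U ∷ D ∷ w) = trans (cong (_+ toℕ (endsWith U (D ∷ w))) (+-suc (occ U U (D ∷ w)) (occ U D (D ∷ w))))
                            (cong suc (ups-occ (D ∷ w)))
ups-occ (D ∷ U ∷ w) = ups-occ (U ∷ w)
ups-occ (D ∷ D ∷ w) = ups-occ (D ∷ w)

downs-occ : ∀ (w : List Step) → occ D D w + occ D U w + toℕ (endsWith D w) ≡ downs w
downs-occ []          = refl
downs-occ (U ∷ [])    = refl
downs-occ (D ∷ [])    = refl
downs-occ (D ∷ D ∷ w) = cong suc (downs-occ (D ∷ w))
downs-occ (D ∷ U ∷ w) = trans (cong (_+ toℕ (endsWith D (U ∷ w))) (+-suc (occ D D (U ∷ w)) (occ D U (U ∷ w))))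
                              (cong suc (downs-occ (U ∷ w)))
downs-occ (U ∷ D ∷ w) = downs-occ (D ∷ w)
downs-occ (U ∷ U ∷ w) = downs-occ (U ∷ w)

peaks-valleys : ∀ x (v : List Step) →
  occ U D (x ∷ v) + toℕ (endsWith U (x ∷ v)) ≡ occ D U (x ∷ v) + toℕ (startsWith U (x ∷ v))
peaks-valleys U []      = refl
peaks-valleys D []      = refl
peaks-valleys U (U ∷ v) = peaks-valleys U v
peaks-valleys U (D ∷ v) = trans (cong suc (peaks-valleys D v)) (trans (cong suc (+-identityʳ _)) (+-comm 1 (occ D U (D ∷ v))))
peaks-valleys D (U ∷ v) = trans (peaks-valleys U v) (trans (+-comm (occ D U (U ∷ v)) 1) (sym (+-identityʳ _)))
peaks-valleys D (D ∷ v) = peaks-valleys D v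

endsWith-D : ∀ x (v : List Step) → endsWith D (x ∷ v) ≡ not (endsWith U (x ∷ v))
endsWith-D U []      = refl
endsWith-D D []      = refl
endsWith-D x (y ∷ v) = endsWith-D y v

endsWith-U-false : ∀ x (v : List Step) → endsWith D (x ∷ v) ≡ true → endsWith U (x ∷ v) ≡ false
endsWith-U-false D []      _ = refl
endsWith-U-false x (y ∷ v) e = endsWith-U-false y v e

peaks≡1+valleys : ∀ v → endsWith D (U ∷ v) ≡ true → occ U D (U ∷ v) ≡ suc (occ D U (U ∷ v))
peaks≡1+valleys v e = begin
    occ U D (U ∷ v)
  ≡⟨ +-identityʳ _ ⟨
    occ U D (U ∷ v) + 0
  ≡⟨ cong (λ b → occ U D (U ∷ v) + toℕ b) (endsWith-U-false U v e) ⟨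
    occ U D (U ∷ v) + toℕ (endsWith U (U ∷ v))
  ≡⟨ peaks-valleys U v ⟩
    occ D U (U ∷ v) + 1
  ≡⟨ +-comm (occ D U (U ∷ v)) 1 ⟩
    suc (occ D U (U ∷ v))
  ∎
  where open ≡-Reasoning

valleys≡1+peaks : ∀ v → endsWith U (D ∷ v) ≡ true → occ D U (D ∷ v) ≡ suc (occ U D (D ∷ v))
valleys≡1+peaks v e = begin
    occ D U (D ∷ v)
  ≡⟨ +-identityʳ _ ⟨
    occ D U (D ∷ v) + 0
  ≡⟨ peaks-valleys D v ⟨
    occ U D (D ∷ v) + toℕ (endsWith U (D ∷ v))
  ≡⟨ cong (λ b → occ U D (D ∷ v) + toℕ b) e ⟩
    occ U D (D ∷ v) + 1
  ≡⟨ +-comm (occ U D (D ∷ v)) 1 ⟩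
    suc (occ U D (D ∷ v))
  ∎
  where open ≡-Reasoning

peaks≡valleys : ∀ v → endsWith D (D ∷ v) ≡ true → occ U D (D ∷ v) ≡ occ D U (D ∷ v)
peaks≡valleys v e = begin
    occ U D (D ∷ v)
  ≡⟨ +-identityʳ _ ⟨
    occ U D (D ∷ v) + 0
  ≡⟨ cong (λ b → occ U D (D ∷ v) + toℕ b) (endsWith-U-false D v e) ⟨
    occ U D (D ∷ v) + toℕ (endsWith U (D ∷ v))
  ≡⟨ peaks-valleys D v ⟩
    occ D U (D ∷ v) + 0
  ≡⟨ +-identityʳ _ ⟩
    occ D U (D ∷ v)
  ∎
  where open ≡-Reasoning

ups+downs : ∀ (w : List Step) → ups w + downs w ≡ length w
ups+downs []      = refl
ups+downs (U ∷ w) = cong suc (ups+downs w)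
ups+downs (D ∷ w) = trans (+-suc (ups w) (downs w)) (cong suc (ups+downs w))

heightFrom-counts : ∀ r h (w : List Step) → heightFrom r h w +ℤ ℤ.+ (r * downs w) ≡ h +ℤ ℤ.+ ups w
heightFrom-counts r h []      = cong (λ z → h +ℤ ℤ.+ z) (*-zeroʳ r)
heightFrom-counts r h (U ∷ w) = begin
    heightFrom r (h +ℤ 1ℤ) w +ℤ ℤ.+ (r * downs w)
  ≡⟨ heightFrom-counts r (h +ℤ 1ℤ) w ⟩
    (h +ℤ 1ℤ) +ℤ ℤ.+ ups w
  ≡⟨ ℤ.+-assoc h 1ℤ (ℤ.+ ups w) ⟩
    h +ℤ ℤ.+ suc (ups w)
  ∎
  where open ≡-Reasoning
heightFrom-counts r h (D ∷ w) = begin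
    heightFrom r h′ w +ℤ ℤ.+ (r * suc (downs w))
  ≡⟨ cong (λ z → heightFrom r h′ w +ℤ z) (trans (cong ℤ.+_ (*-suc r (downs w))) (ℤ.pos-+ r (r * downs w))) ⟩
    heightFrom r h′ w +ℤ (ℤ.+ r +ℤ ℤ.+ (r * downs w))
  ≡⟨ swap (heightFrom r h′ w) (ℤ.+ r) (ℤ.+ (r * downs w)) ⟩
    (heightFrom r h′ w +ℤ ℤ.+ (r * downs w)) +ℤ ℤ.+ r
  ≡⟨ cong (_+ℤ ℤ.+ r) (heightFrom-counts r h′ w) ⟩
    (h′ +ℤ ℤ.+ ups w) +ℤ ℤ.+ r
  ≡⟨ cancel h (ℤ.+ r) (ℤ.+ ups w) ⟩
    h +ℤ ℤ.+ ups w
  ∎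
  where
  open ≡-Reasoning
  h′ = h +ℤ ℤ.- ℤ.+ r
  swap : ∀ (x a b : ℤ) → x +ℤ (a +ℤ b) ≡ (x +ℤ b) +ℤ a
  swap = ℤ-Solver.solve-∀
  cancel : ∀ (x a b : ℤ) → ((x +ℤ ℤ.- a) +ℤ b) +ℤ a ≡ x +ℤ b
  cancel = ℤ-Solver.solve-∀

==ℤ-sound : ∀ {a b} → (a ==ℤ b) ≡ true → a ≡ b
==ℤ-sound {a} {b} e = ℤ.≤-antisym (≤ᵇℤ-sound (∧-true-left e)) (≤ᵇℤ-sound (∧-true-right {a ≤ᵇℤ b} e))

==ℤ-complete : ∀ {a b} → a ≡ b → (a ==ℤ b) ≡ true
==ℤ-complete {a} refl rewrite ≤ᵇℤ-true (ℤ.≤-refl {a}) = refl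

module Paths (n r : ℕ) where

  N : ℕ
  N = suc r * n + 1

  1≤N : 1 ≤ N
  1≤N = m≤n+m 1 (suc r * n)

  N≡ : N ≡ suc (r * n) + n
  N≡ = rearrange r n
    where
    rearrange : ∀ r n → suc r * n + 1 ≡ suc (r * n) + n
    rearrange = ℕ-Solver.solve-∀

  inP-rotate : ∀ w → inP n r (rotate w) ≡ inP n r w
  inP-rotate []      = refl
  inP-rotate (x ∷ w) = cong₂ _∧_ (cong (_≡ᵇ N) (trans (length-++ w) (+-comm (length w) 1)))
    (cong (_==ℤ 1ℤ) (trans (heightFrom-++ r 0ℤ w [ x ]) (sym (heightFrom-raise r 0ℤ (val r x) w))))

  inP-shape : ∀ w → inP n r w ≡ true → length w ≡ N × heightFrom r 0ℤ w ≡ 1ℤ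
  inP-shape w e = ≡ᵇ-sound (∧-true-left e) , ==ℤ-sound (∧-true-right {length w ≡ᵇ N} e)

  downs≡n : ∀ w → length w ≡ N → ups w ≡ suc (r * n) → downs w ≡ n
  downs≡n w ∣w∣ ups≡ = +-cancelˡ-≡ (suc (r * n)) _ _
    (trans (cong (_+ downs w) (sym ups≡)) (trans (ups+downs w) (trans ∣w∣ N≡)))

  ups≡1+r*downs⇒downs≡n : ∀ w → length w ≡ N → ups w ≡ suc (r * downs w) → downs w ≡ n
  ups≡1+r*downs⇒downs≡n w ∣w∣ ups≡ = *-cancelˡ-≡ (downs w) n (suc r) (+-cancelʳ-≡ 1 _ _ (begin
      suc r * downs w + 1
    ≡⟨ rearrange r (downs w) ⟩
      suc (r * downs w) + downs w
    ≡⟨ cong (_+ downs w) ups≡ ⟨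
      ups w + downs w
    ≡⟨ trans (ups+downs w) ∣w∣ ⟩
      suc r * n + 1
    ∎))
    where
    open ≡-Reasoning
    rearrange : ∀ r d → suc r * d + 1 ≡ suc (r * d) + d
    rearrange = ℕ-Solver.solve-∀

  heightFrom≡1⇔ : ∀ w → length w ≡ N → (heightFrom r 0ℤ w ≡ 1ℤ) ⇔ (ups w ≡ suc (r * n))
  heightFrom≡1⇔ w ∣w∣ = mk⇔ to from
    where
    counts = heightFrom-counts r 0ℤ w
    to : heightFrom r 0ℤ w ≡ 1ℤ → ups w ≡ suc (r * n)
    to h≡1 = trans ups≡ (cong (λ d → suc (r * d)) (ups≡1+r*downs⇒downs≡n w ∣w∣ ups≡))
      where
      ups≡ : ups w ≡ suc (r * downs w)
      ups≡ = sym (ℤ.+-injective (trans (cong (_+ℤ ℤ.+ (r * downs w)) (sym h≡1)) counts))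
    from : ups w ≡ suc (r * n) → heightFrom r 0ℤ w ≡ 1ℤ
    from ups≡ = +ℤ-cancelʳ (ℤ.+ (r * n)) _ _ (begin
        heightFrom r 0ℤ w +ℤ ℤ.+ (r * n)
      ≡⟨ cong (λ d → heightFrom r 0ℤ w +ℤ ℤ.+ (r * d)) (downs≡n w ∣w∣ ups≡) ⟨
        heightFrom r 0ℤ w +ℤ ℤ.+ (r * downs w)
      ≡⟨ trans counts (cong ℤ.+_ ups≡) ⟩
        1ℤ +ℤ ℤ.+ (r * n)
      ∎)
      where open ≡-Reasoning

  inP-ups : ∀ w → length w ≡ N → inP n r w ≡ (ups w ≡ᵇ suc (r * n))
  inP-ups w ∣w∣ rewrite ≡ᵇ-true ∣w∣ = Bool-ext
    (λ e → ≡ᵇ-true (Equivalence.to (heightFrom≡1⇔ w ∣w∣) (==ℤ-sound e)))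
    (λ e → ==ℤ-complete (Equivalence.from (heightFrom≡1⇔ w ∣w∣) (≡ᵇ-sound e)))

  ups-inP : ∀ w → inP n r w ≡ true → ups w ≡ suc (r * n)
  ups-inP w e = ≡ᵇ-sound (trans (sym (inP-ups w (proj₁ (inP-shape w e)))) e)

  downs-inP : ∀ w → inP n r w ≡ true → downs w ≡ n
  downs-inP w e = downs≡n w (proj₁ (inP-shape w e)) (ups-inP w e)

  instance
    N-nonZero : NonZero N
    N-nonZero = >-nonZero 1≤N

  module Occurrences (a b : Step) (K : ℕ) where
    open CycleLemma r N (inP n r) inP-rotate inP-shape (isFactor a b) (isFactor a b) (λ _ _ → refl) (λ _ _ → refl) (suc K)

    Framed : List Step → Bool
    Framed w = inP n r w ∧ ((occ a b w ≡ᵇ K) ∧ (startsWith b w ∧ endsWith a w))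

    Fibre : ℕ → List Step → Bool
    Fibre j w = inP n r w ∧ ((occ a b w ≡ᵇ K) ∧ (startsWith b w ∧ (endsWith a w ∧ (lowOcc r a b w ≡ᵇ j))))

    Fibre≡ : ∀ j w → Fibre j w ≡ Framed w ∧ (lowOcc r a b w ≡ᵇ j)
    Fibre≡ j w = sym (trans (∧-assoc (inP n r w) _ _) (cong (inP n r w ∧_)
                 (trans (∧-assoc (occ a b w ≡ᵇ K) _ _) (cong ((occ a b w ≡ᵇ K) ∧_) (∧-assoc (startsWith b w) _ _)))))

    lowOcc-range : ∀ w → Framed w ≡ true → 0 ≤ lowOcc r a b w × lowOcc r a b w < 0 + suc K
    lowOcc-range w e = z≤n , s≤s (subst (lowOcc r a b w ≤_) (≡ᵇ-sound (∧-true-left (∧-true-right {inP n r w} e)))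
                                        (lowOccFrom≤occ r a b 0ℤ w))

    N*Fibre : ∀ j → 0 ≤ j → j < 0 + suc K → N * count (Fibre j) (words N) ≡ count Global (words N)
    N*Fibre j _ (s≤s j≤K) = trans (cong (N *_) (count-words-cong-∷ 1≤N λ x v →
                                    cong (inP n r (x ∷ v) ∧_) (occurrences-cyclic r a b K j x v)))
                                  (cycle-lemma (suc j) (s≤s z≤n) λ w G →
                                    subst (suc j ≤_) (sym (≡ᵇ-sound (∧-true-right {inP n r w} G))) (s≤s j≤K))

    lowOcc-equidistributed : ∀ j → j ≤ K → suc K * count (Fibre j) (words N) ≡ count Framed (words N)
    lowOcc-equidistributed j j≤K =
      equidistribution (words N) Framed (lowOcc r a b) Fibre Fibre≡ (suc K) 0 lowOcc-range N _ N*Fibre j z≤n (s≤s j≤K)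

  module LowStarts (s a b : Step) (s≢b : (s ==ˢ b) ≡ false) (K : ℕ)
    (#s≡K : ∀ w → inP n r w ≡ true → count (_==ˢ s) w ≡ K) (k : ℕ) where
    open CycleLemma r N (inP n r) inP-rotate inP-shape (leaves s) (isFactor a b) (λ _ _ → refl) (λ _ _ → refl) k

    Starting : List Step → Bool
    Starting w = inP n r w ∧ ((occ a b w ≡ᵇ k) ∧ startsWith s w)

    Fibre : ℕ → List Step → Bool
    Fibre j w = inP n r w ∧ ((occ a b w ≡ᵇ k) ∧ (startsWith s w ∧ (lowStarts r s w ≡ᵇ j)))

    Fibre≡ : ∀ j w → Fibre j w ≡ Starting w ∧ (lowStarts r s w ≡ᵇ j)
    Fibre≡ j w = sym (trans (∧-assoc (inP n r w) _ _) (cong (inP n r w ∧_) (∧-assoc (occ a b w ≡ᵇ k) _ _)))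

    lowStarts-range : ∀ w → Starting w ≡ true → 1 ≤ lowStarts r s w × lowStarts r s w < 1 + K
    lowStarts-range w e =
      first-is-low w (∧-true-right (∧-true-right {inP n r w} e)) ,
      s≤s (subst (lowStarts r s w ≤_) (#s≡K w (∧-true-left e)) (lowStartsFrom≤count r s 0ℤ w))
      where
      first-is-low : ∀ w → startsWith s w ≡ true → 1 ≤ lowStarts r s w
      first-is-low (x ∷ w) x≡s rewrite x≡s = s≤s z≤n

    N*Fibre : ∀ j → 1 ≤ j → j < 1 + K → N * count (Fibre j) (words N) ≡ count Global (words N)
    N*Fibre j 1≤j (s≤s j≤K) = trans (cong (N *_) (count-words-cong-∷ 1≤N λ x v →
                                       cong (inP n r (x ∷ v) ∧_) (lowStarts-cyclic r a b s s≢b k j x v)))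
                                     (cycle-lemma j 1≤j λ w G →
                                       subst (j ≤_) (sym (trans (count-leaves r s 0ℤ (lastStep w) w)
                                                                (#s≡K w (∧-true-left G)))) j≤K)

    lowStarts-equidistributed : ∀ j → 1 ≤ j → j ≤ K → K * count (Fibre j) (words N) ≡ count Starting (words N)
    lowStarts-equidistributed j 1≤j j≤K =
      equidistribution (words N) Starting (lowStarts r s) Fibre Fibre≡ K 1 lowStarts-range N _ N*Fibre j 1≤j (s≤s j≤K)

  PeaksOn : Step → Step → (List Step → Bool) → ℕ → Set
  PeaksOn s e o p = ∀ w → length w ≡ N → ups w ≡ suc (r * n) → startsWith s w ≡ true → endsWith e w ≡ true →
    o w ≡ (occ U D w ≡ᵇ p)

  count-by-shape : ∀ (o : List Step → Bool) s e p → PeaksOn s e o p →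
    count (λ w → inP n r w ∧ (o w ∧ (startsWith s w ∧ endsWith e w))) (words N) ≡ shapeCount s e (suc (r * n)) n p
  count-by-shape o s e p o≡ = trans
    (count-words-cong λ w ∣w∣ → trans (cong (_∧ (o w ∧ (startsWith s w ∧ endsWith e w))) (inP-ups w ∣w∣))
                                      (reorder _ (o w) _ _ _ λ ups≡ s≡ e≡ → o≡ w ∣w∣ (≡ᵇ-sound ups≡) s≡ e≡))
    (count-Shape⁺ s e (suc (r * n)) n p (sym N≡) 1≤N)

  count-by-shape-and-end : ∀ (o : List Step → Bool) s pU pD → PeaksOn s U o pU → PeaksOn s D o pD →
    count (λ w → inP n r w ∧ (o w ∧ startsWith s w)) (words N)
      ≡ shapeCount s U (suc (r * n)) n pU + shapeCount s D (suc (r * n)) n pD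
  count-by-shape-and-end o s pU pD o≡U o≡D = begin
      count P (words N)
    ≡⟨ count-∧-split P (endsWith U) (words N) ⟩
      count (λ w → P w ∧ endsWith U w) (words N) + count (λ w → P w ∧ not (endsWith U w)) (words N)
    ≡⟨ cong (count (λ w → P w ∧ endsWith U w) (words N) +_)
            (count-words-cong-∷ 1≤N λ x v → cong (P (x ∷ v) ∧_) (sym (endsWith-D x v))) ⟩
      count (λ w → P w ∧ endsWith U w) (words N) + count (λ w → P w ∧ endsWith D w) (words N)
    ≡⟨ cong₂ _+_ (trans (count-cong (words N) (λ w → ∧-assoc₃ (inP n r w) (o w) (startsWith s w) (endsWith U w)))
                        (count-by-shape o s U pU o≡U))
                 (trans (count-cong (words N) (λ w → ∧-assoc₃ (inP n r w) (o w) (startsWith s w) (endsWith D w)))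
                        (count-by-shape o s D pD o≡D)) ⟩
      shapeCount s U (suc (r * n)) n pU + shapeCount s D (suc (r * n)) n pD
    ∎
    where
    open ≡-Reasoning
    P = λ w → inP n r w ∧ (o w ∧ startsWith s w)

module Identities (n′ r : ℕ) where
  open Paths (suc n′) r

  peaks-identity : ∀ k′ j → j ≤ k′ →
    suc k′ * #P (suc n′) r (λ w → (occ U D w ≡ᵇ k′) ∧ startsWith D w ∧ endsWith U w ∧ (lowOcc r U D w ≡ᵇ j))
      ≡ ((r * suc n′) C k′) * (n′ C k′)
  peaks-identity k′ j j≤k′ =
    trans (Occurrences.lowOcc-equidistributed U D k′ j j≤k′) (count-by-shape _ D U k′ λ _ _ _ _ _ → refl)

  valleys-identity : ∀ k′ j → j ≤ k′ →
    suc k′ * #P (suc n′) r (λ w → (occ D U w ≡ᵇ k′) ∧ startsWith U w ∧ endsWith D w ∧ (lowOcc r D U w ≡ᵇ j))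
      ≡ ((r * suc n′) C k′) * (n′ C k′)
  valleys-identity k′ j j≤k′ =
    trans (Occurrences.lowOcc-equidistributed D U k′ j j≤k′) (count-by-shape _ U D (suc k′) valleys≡)
    where
    valleys≡ : PeaksOn U D (λ w → occ D U w ≡ᵇ k′) (suc k′)
    valleys≡ (U ∷ v) _ _ _  ends = cong (_≡ᵇ suc k′) (sym (peaks≡1+valleys v ends))
    valleys≡ (D ∷ v) _ _ () _

  doubleRises-identity : ∀ k′ j → j + suc k′ ≤ r * suc n′ →
    (r * suc n′ ∸ suc k′ + 1) * #P (suc n′) r (λ w → (occ U U w ≡ᵇ (r * suc n′ ∸ suc k′))
                                                      ∧ startsWith U w ∧ endsWith U w ∧ (lowOcc r U U w ≡ᵇ j))
      ≡ ((r * suc n′) C suc k′) * (n′ C k′)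
  doubleRises-identity k′ j j+k≤rn = begin
      (K + 1) * count (Fibre j) (words N)
    ≡⟨ cong (_* count (Fibre j) (words N)) (+-comm K 1) ⟩
      suc K * count (Fibre j) (words N)
    ≡⟨ lowOcc-equidistributed j (m+n≤o⇒m≤o∸n j j+k≤rn) ⟩
      count Framed (words N)
    ≡⟨ count-by-shape _ U U (suc k′) doubleRises≡ ⟩
      ((r * suc n′) C suc k′) * (n′ C k′)
    ∎
    where
    open ≡-Reasoning
    K = r * suc n′ ∸ suc k′
    open Occurrences U U K
    doubleRises≡ : PeaksOn U U (λ w → occ U U w ≡ᵇ K) (suc k′)
    doubleRises≡ w _ ups≡ _ ends = ≡ᵇ-cancelˡ (occ U U w) (occ U D w) K (suc k′) (+-cancelʳ-≡ 1 _ _ (begin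
        occ U U w + occ U D w + 1
      ≡⟨ cong (λ b → occ U U w + occ U D w + toℕ b) ends ⟨
        occ U U w + occ U D w + toℕ (endsWith U w)
      ≡⟨ ups-occ w ⟩
        ups w
      ≡⟨ ups≡ ⟩
        suc (r * suc n′)
      ≡⟨ cong suc (m∸n+n≡m (≤-trans (m≤n+m (suc k′) j) j+k≤rn)) ⟨
        suc (K + suc k′)
      ≡⟨ +-comm 1 (K + suc k′) ⟩
        K + suc k′ + 1
      ∎))

  doubleFalls-identity : ∀ k′ → k′ < n′ → ∀ j → j + suc k′ < suc n′ →
    (n′ ∸ k′) * #P (suc n′) r (λ w → (occ D D w ≡ᵇ (n′ ∸ k′ ∸ 1))
                                      ∧ startsWith D w ∧ endsWith D w ∧ (lowOcc r D D w ≡ᵇ j))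
      ≡ ((r * suc n′) C k′) * (n′ C suc k′)
  doubleFalls-identity k′ k′<n′ j (s≤s j+k≤n′) rewrite +-∸-assoc 1 k′<n′ =
    trans (lowOcc-equidistributed j (m+n≤o⇒m≤o∸n j j+k≤n′)) (count-by-shape _ D D (suc k′) doubleFalls≡)
    where
    open ≡-Reasoning
    K = n′ ∸ suc k′
    open Occurrences D D K
    doubleFalls≡ : PeaksOn D D (λ w → occ D D w ≡ᵇ K) (suc k′)
    doubleFalls≡ (U ∷ v) _ _ () _
    doubleFalls≡ w@(D ∷ v) ∣w∣ ups≡ _ ends = ≡ᵇ-cancelˡ (occ D D w) (occ U D w) K (suc k′) (+-cancelʳ-≡ 1 _ _ (begin
        occ D D w + occ U D w + 1
      ≡⟨ cong (λ m → occ D D w + m + 1) (peaks≡valleys v ends) ⟩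
        occ D D w + occ D U w + 1
      ≡⟨ cong (λ b → occ D D w + occ D U w + toℕ b) ends ⟨
        occ D D w + occ D U w + toℕ (endsWith D w)
      ≡⟨ downs-occ w ⟩
        downs w
      ≡⟨ downs≡n w ∣w∣ ups≡ ⟩
        suc n′
      ≡⟨ cong suc (m∸n+n≡m k′<n′) ⟨
        suc (K + suc k′)
      ≡⟨ +-comm 1 (K + suc k′) ⟩
        K + suc k′ + 1
      ∎))

  lowUps-identity : ∀ k′ j → 1 ≤ j → j ≤ r * suc n′ + 1 →
    (r * suc n′ + 1) * #P (suc n′) r (λ w → (occ U D w ≡ᵇ suc k′) ∧ startsWith U w ∧ (lowStarts r U w ≡ᵇ j))
      ≡ ((r * suc n′ + 1) C suc k′) * (n′ C k′)
  lowUps-identity k′ j 1≤j j≤ = begin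
      (rn + 1) * count (Fibre j) (words N)
    ≡⟨ lowStarts-equidistributed j 1≤j j≤ ⟩
      count Starting (words N)
    ≡⟨ count-by-shape-and-end _ U (suc k′) (suc k′) (λ _ _ _ _ _ → refl) (λ _ _ _ _ _ → refl) ⟩
      (rn C suc k′) * (n′ C k′) + (rn C k′) * (n′ C k′)
    ≡⟨ *-distribʳ-+ (n′ C k′) (rn C suc k′) (rn C k′) ⟨
      (rn C suc k′ + rn C k′) * (n′ C k′)
    ≡⟨ cong (_* (n′ C k′)) (trans (+-comm (rn C suc k′) (rn C k′))
                                  (trans (nCk+nC[k+1]≡[n+1]C[k+1] rn k′) (cong (_C suc k′) (+-comm 1 rn)))) ⟩
      ((rn + 1) C suc k′) * (n′ C k′)
    ∎
    where
    open ≡-Reasoning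
    rn = r * suc n′
    open LowStarts U U D refl (rn + 1) (λ w e → trans (ups-inP w e) (+-comm 1 rn)) (suc k′)

  lowDowns-identity : ∀ k′ j → 1 ≤ j → j ≤ suc n′ →
    suc n′ * #P (suc n′) r (λ w → (occ D U w ≡ᵇ suc k′) ∧ startsWith D w ∧ (lowStarts r D w ≡ᵇ j))
      ≡ ((r * suc n′) C k′) * (suc n′ C suc k′)
  lowDowns-identity k′ j 1≤j j≤ = begin
      suc n′ * count (Fibre j) (words N)
    ≡⟨ lowStarts-equidistributed j 1≤j j≤ ⟩
      count Starting (words N)
    ≡⟨ count-by-shape-and-end _ D k′ (suc k′) valleys≡U valleys≡D ⟩
      (rn C k′) * (n′ C k′) + (rn C k′) * (n′ C suc k′)
    ≡⟨ *-distribˡ-+ (rn C k′) (n′ C k′) (n′ C suc k′) ⟨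
      (rn C k′) * (n′ C k′ + n′ C suc k′)
    ≡⟨ cong ((rn C k′) *_) (nCk+nC[k+1]≡[n+1]C[k+1] n′ k′) ⟩
      (rn C k′) * (suc n′ C suc k′)
    ∎
    where
    open ≡-Reasoning
    rn = r * suc n′
    open LowStarts D D U refl (suc n′) downs-inP (suc k′)
    valleys≡U : PeaksOn D U (λ w → occ D U w ≡ᵇ suc k′) k′
    valleys≡U (D ∷ v) _ _ _  ends = cong (_≡ᵇ suc k′) (valleys≡1+peaks v ends)
    valleys≡U (U ∷ v) _ _ () _
    valleys≡D : PeaksOn D D (λ w → occ D U w ≡ᵇ suc k′) (suc k′)
    valleys≡D (D ∷ v) _ _ _  ends = cong (_≡ᵇ suc k′) (sym (peaks≡valleys v ends))
    valleys≡D (U ∷ v) _ _ () _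

theorem15 : (n k r : ℕ) → 1 ≤ n → 1 ≤ k → 1 ≤ r →
    ((j : ℕ) → j < k →
      k * #P n r (λ w → (occ U D w ≡ᵇ (k ∸ 1)) ∧ startsWith D w ∧ endsWith U w ∧ (lowOcc r U D w ≡ᵇ j))
        ≡ ((r * n) C (k ∸ 1)) * ((n ∸ 1) C (k ∸ 1)))
    ×
    ((j : ℕ) → j < k →
      k * #P n r (λ w → (occ D U w ≡ᵇ (k ∸ 1)) ∧ startsWith U w ∧ endsWith D w ∧ (lowOcc r D U w ≡ᵇ j))
        ≡ ((r * n) C (k ∸ 1)) * ((n ∸ 1) C (k ∸ 1)))
    ×
    ((j : ℕ) → j + k ≤ r * n →
      (r * n ∸ k + 1) * #P n r (λ w → (occ U U w ≡ᵇ (r * n ∸ k)) ∧ startsWith U w ∧ endsWith U w ∧ (lowOcc r U U w ≡ᵇ j))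
        ≡ ((r * n) C k) * ((n ∸ 1) C (k ∸ 1)))
    ×
    (k < n → (j : ℕ) → j + k < n →
      (n ∸ k) * #P n r (λ w → (occ D D w ≡ᵇ (n ∸ k ∸ 1)) ∧ startsWith D w ∧ endsWith D w ∧ (lowOcc r D D w ≡ᵇ j))
        ≡ ((r * n) C (k ∸ 1)) * ((n ∸ 1) C k))
    ×
    ((j : ℕ) → 1 ≤ j → j ≤ r * n + 1 →
      (r * n + 1) * #P n r (λ w → (occ U D w ≡ᵇ k) ∧ startsWith U w ∧ (lowStarts r U w ≡ᵇ j))
        ≡ ((r * n + 1) C k) * ((n ∸ 1) C (k ∸ 1)))
    ×
    ((j : ℕ) → 1 ≤ j → j ≤ n →
      n * #P n r (λ w → (occ D U w ≡ᵇ k) ∧ startsWith D w ∧ (lowStarts r D w ≡ᵇ j))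
        ≡ ((r * n) C (k ∸ 1)) * (n C k))
theorem15 (suc n′) (suc k′) r _ _ _ =
  (λ j j<k → peaks-identity k′ j (≤-pred j<k)) ,
  (λ j j<k → valleys-identity k′ j (≤-pred j<k)) ,
  doubleRises-identity k′ ,
  (λ k<n → doubleFalls-identity k′ (≤-pred k<n)) ,
  lowUps-identity k′ ,
  lowDowns-identity k′
  where open Identities n′ r
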